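{- If a sequent $\sigma$ is valid over the class of S5 frames, then $\sigma$ has a cyclic proof in $\mathrm{cICKS5}$ in which every occurring sequent $\Gamma\Rightarrow\Delta$ satisfies $\Gamma^-\cup\Delta^-\subseteq\mathrm{Cl}^\neg(\sigma)$ (in particular all cut formulae lie in $\mathrm{Cl}^\neg(\sigma)$).
   Context: Formulae over a finite non-empty set $\mathsf{A}$ of agents and atoms $\mathrm{Prop}$: $\varphi ::= \bot \mid p \mid \varphi\wedge\varphi\mid\varphi\vee\varphi\mid\varphi\to\varphi\mid K_a\varphi\mid C\varphi$; $\neg\varphi:=\varphi\to\bot$. A set of formulae is negation closed if: $\psi_1\ast\psi_2$ in it ($\ast\in\{\wedge,\vee,\to\}$) implies $\psi_1,\psi_2$ in it; $K_a\psi$ in it implies $\psi$ and $\neg K_a\psi$ in it; $C\psi$ in it implies $\psi$ and $K_aC\psi$ (all $a$) in it. $\mathrm{Cl}^\neg(\sigma)$ is the smallest negation closed set containing all formulae occurring (unannotated) in $\sigma$. S5 semantics: frames $(\mathcal{W},\leq,\{R_a\})$, $\mathcal{W}\neq\emptyset$, $\leq$ a partial order, each $R_a$ an equivalence relation, triangle confluence ($w\leq v$, $vR_au$ imply $wR_au$); models add a $\leq$-monotone valuation; $w\models\varphi\to\psi$ iff for all $v\geq w$, $v\models\varphi$ implies $v\models\psi$; $w\models K_a\varphi$ iff all $R_a$-successors satisfy $\varphi$; $w\models C\varphi$ iff all $R^*$-successors satisfy $\varphi$; atoms, $\bot,\wedge,\vee$ as usual. Sequents: annotated formulae $\varphi^x$,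 $x\in\{\mathsf{u},\mathsf{f}\}$; $\Gamma^-$ the underlying formulae; $K_a\Gamma=\{(K_a\psi)^x:\psi^x\in\Gamma\}$; a sequent $\Gamma\Rightarrow\Delta$ has finite sets, all of $\Gamma$ unfocused, at most one focused formula in $\Delta$, of form $C\psi$ or $K_aC\psi$; valid over a class if $\bigwedge\Gamma^-\to\bigvee\Delta^-$ is. Rules of $\mathrm{cICKS5}$ (premises / conclusion; $x\in\{\mathsf{u},\mathsf{f}\}$; premises and conclusion must be sequents): id: $\Gamma,\varphi^{\mathsf{u}}\Rightarrow\varphi^x,\Delta$; $\bot$: $\Gamma,\bot^{\mathsf{u}}\Rightarrow\Delta$; $\wedge$L: $\Gamma,\varphi^{\mathsf{u}},\psi^{\mathsf{u}}\Rightarrow\Delta$ / $\Gamma,(\varphi\wedge\psi)^{\mathsf{u}}\Rightarrow\Delta$; $\wedge$R: $\Gamma\Rightarrow\varphi^{\mathsf{u}},\Delta$, $\Gamma\Rightarrow\psi^{\mathsf{u}},\Delta$ / $\Gamma\Rightarrow(\varphi\wedge\psi)^{\mathsf{u}},\Delta$; $\vee$L: $\Gamma,\varphi^{\mathsf{u}}\Rightarrow\Delta$, $\Gamma,\psi^{\mathsf{u}}\Rightarrow\Delta$ / $\Gamma,(\varphi\vee\psi)^{\mathsf{u}}\Rightarrow\Delta$; $\vee$R: $\Gamma\Rightarrow\varphi^{\mathsf{u}},\psi^{\mathsf{u}},\Delta$ / $\Gamma\Rightarrow(\varphi\vee\psi)^{\mathsf{u}},\Delta$; $\to$L: $\Gamma\Rightarrow\varphi^{\mathsf{u}},\Delta$,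 $\Gamma,\psi^{\mathsf{u}}\Rightarrow\Delta$ / $\Gamma,(\varphi\to\psi)^{\mathsf{u}}\Rightarrow\Delta$; $\to$R: $\Gamma,\varphi^{\mathsf{u}}\Rightarrow\psi^{\mathsf{u}}$ / $\Gamma\Rightarrow(\varphi\to\psi)^{\mathsf{u}},\Delta$; u: $\Gamma\Rightarrow\varphi^{\mathsf{u}},\Delta$ / $\Gamma\Rightarrow\varphi^{\mathsf{f}},\Delta$; f: $\Gamma\Rightarrow\varphi^{\mathsf{f}},\Delta$ / $\Gamma\Rightarrow\varphi^{\mathsf{u}},\Delta$; $\mathsf{T}_a$: $\Gamma,\varphi^{\mathsf{u}}\Rightarrow\Delta$ / $\Gamma,(K_a\varphi)^{\mathsf{u}}\Rightarrow\Delta$; $\mathsf{S5}_a$: $K_a\Gamma\Rightarrow\varphi^x,K_a\Delta$ / $\Pi,K_a\Gamma\Rightarrow(K_a\varphi)^x,K_a\Delta,\Sigma$; $\mathsf{K}_a{\to}$: $\Gamma,(K_a\varphi)^{\mathsf{u}}\Rightarrow\psi^{\mathsf{u}},\Delta$ / $\Gamma\Rightarrow(K_a\varphi\to\psi)^{\mathsf{u}},\Delta$; CL: $\Gamma,\varphi^{\mathsf{u}},\{(K_aC\varphi)^{\mathsf{u}}\}_a\Rightarrow\Delta$ / $\Gamma,(C\varphi)^{\mathsf{u}}\Rightarrow\Delta$; CR: $\Gamma\Rightarrow\varphi^{\mathsf{u}},\Delta$ and for each $a$, $\Gamma\Rightarrow(K_aC\varphi)^x,\Delta$ / $\Gamma\Rightarrow(C\varphi)^x,\Delta$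 ($C\varphi$ principal); cut: $\Gamma,\varphi^{\mathsf{u}}\Rightarrow\Delta$, $\Gamma\Rightarrow\varphi^{\mathsf{u}},\Delta$ / $\Gamma\Rightarrow\Delta$. A cyclic proof of $\sigma$ is a finite tree labelled by sequents, root $\sigma$, each inner node and its children a rule instance, in which every leaf is an axiom instance (id or $\bot$) or the upper node $v$ of a successful repetition $(u,v)$: distinct nodes with identical sequents, $v$ a descendant of $u$, every sequent on the path from $u$ to $v$ has a focused formula, and this path passes through a CR instance whose principal formula is in focus. -}

module Defs where

open import Level using (Level)
open import Data.Nat using (ℕ)
open import Data.Fin using (Fin)
open import Data.Bool using (Bool; true; false)
open import Data.Empty using (⊥)
open import Data.Product using (Σ; ∃; _×_; _,_; proj₁; proj₂)
open import Data.Sum using (_⊎_)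
open import Data.List using (List; []; _∷_; [_]; _++_; map; allFin; foldr)
open import Data.List.Membership.Propositional using (_∈_)
open import Data.List.Relation.Unary.All using (All)
open import Data.List.Relation.Unary.Any using (Any)
open import Relation.Binary.PropositionalEquality using (_≡_)
open import Relation.Binary.Construct.Closure.ReflexiveTransitive using (Star)

infixr 12 _∧'_
infixr 11 _∨'_
infixr 10 _⇒'_

data Fm (m : ℕ) : Set where
  ⊥'   : Fm m
  atom : ℕ → Fm m
  _∧'_ : Fm m → Fm m → Fm m
  _∨'_ : Fm m → Fm m → Fm m
  _⇒'_ : Fm m → Fm m → Fm m
  K    : Fin m → Fm m → Fm m
  C    : Fm m → Fm m

¬' : ∀ {m} → Fm m → Fm m
¬' φ = φ ⇒' ⊥'

⊤' : ∀ {m} → Fm m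
⊤' = ⊥' ⇒' ⊥'

record Frame (m : ℕ) : Set₁ where
  field
    W        : Set
    inhabited : W
    _≤_      : W → W → Set
    ≤-refl   : ∀ {w} → w ≤ w
    ≤-trans  : ∀ {w v u} → w ≤ v → v ≤ u → w ≤ u
    ≤-antisym : ∀ {w v} → w ≤ v → v ≤ w → w ≡ v
    R        : Fin m → W → W → Set
    R-refl   : ∀ {a w} → R a w w
    R-sym    : ∀ {a w v} → R a w v → R a v w
    R-trans  : ∀ {a w v u} → R a w v → R a v u → R a w u
    confluence : ∀ {a w v u} → w ≤ v → R a v u → R a w u

record Model (m : ℕ) : Set₁ where
  field
    frame : Frame m
  open Frame frame public
  field
    V    : W → ℕ → Set
    V-mono : ∀ {w v p} → w ≤ v → V w p → V v p

module _ {m : ℕ} (M : Model m) where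
  open Model M

  Rany : W → W → Set
  Rany w v = Σ (Fin m) λ a → R a w v

  _⊩_ : W → Fm m → Set
  w ⊩ ⊥'       = ⊥
  w ⊩ atom p   = V w p
  w ⊩ (φ ∧' ψ) = (w ⊩ φ) × (w ⊩ ψ)
  w ⊩ (φ ∨' ψ) = (w ⊩ φ) ⊎ (w ⊩ ψ)
  w ⊩ (φ ⇒' ψ) = ∀ v → w ≤ v → v ⊩ φ → v ⊩ ψ
  w ⊩ K a φ    = ∀ v → R a w v → v ⊩ φ
  w ⊩ C φ      = ∀ v → Star Rany w v → v ⊩ φ

-- Annotated formulae and sequents (finite sets represented as lists,
-- compared up to having the same elements)

data Ann : Set where
  𝕦 𝕗 : Ann

AF : ℕ → Set
AF m = Fm m × Ann

infix 3 _⟹_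
record Seq (m : ℕ) : Set where
  constructor _⟹_
  field
    lhs : List (AF m)
    rhs : List (AF m)
open Seq public

_≋_ : ∀ {A : Set} → List A → List A → Set
xs ≋ ys = ∀ x → (x ∈ xs → x ∈ ys) × (x ∈ ys → x ∈ xs)

_≈ₛ_ : ∀ {m} → Seq m → Seq m → Set
s ≈ₛ t = (lhs s ≋ lhs t) × (rhs s ≋ rhs t)

data Focusable {m} : Fm m → Set where
  isC  : ∀ {ψ} → Focusable (C ψ)
  isKC : ∀ {a ψ} → Focusable (K a (C ψ))

record IsSequent {m} (s : Seq m) : Set where
  field
    lhs-unfocused : ∀ φ x → (φ , x) ∈ lhs s → x ≡ 𝕦
    rhs-atMostOne : ∀ φ ψ → (φ , 𝕗) ∈ rhs s → (ψ , 𝕗) ∈ rhs s → φ ≡ ψ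
    rhs-focusForm : ∀ φ → (φ , 𝕗) ∈ rhs s → Focusable φ

HasFocus : ∀ {m} → Seq m → Set
HasFocus s = ∃ λ φ → (φ , 𝕗) ∈ rhs s

underlying : ∀ {m} → List (AF m) → List (Fm m)
underlying = map proj₁

⋀ ⋁ : ∀ {m} → List (Fm m) → Fm m
⋀ = foldr _∧'_ ⊤'
⋁ = foldr _∨'_ ⊥'

ValidS5 : ∀ {m} → Seq m → Set₁
ValidS5 {m} s = (M : Model m) (w : Model.W M) →
  _⊩_ M w (⋀ (underlying (lhs s)) ⇒' ⋁ (underlying (rhs s)))

Kl : ∀ {m} → Fin m → List (AF m) → List (AF m)
Kl a = map λ { (ψ , x) → (K a ψ , x) }

data Rule {m : ℕ} : Seq m → List (Seq m) → Set where
  id   : ∀ Γ Δ φ x → Rule ((φ , 𝕦) ∷ Γ ⟹ (φ , x) ∷ Δ) []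
  bot  : ∀ Γ Δ → Rule ((⊥' , 𝕦) ∷ Γ ⟹ Δ) []
  ∧L   : ∀ Γ Δ φ ψ → Rule ((φ ∧' ψ , 𝕦) ∷ Γ ⟹ Δ) [ (φ , 𝕦) ∷ (ψ , 𝕦) ∷ Γ ⟹ Δ ]
  ∧R   : ∀ Γ Δ φ ψ → Rule (Γ ⟹ (φ ∧' ψ , 𝕦) ∷ Δ)
                          ((Γ ⟹ (φ , 𝕦) ∷ Δ) ∷ (Γ ⟹ (ψ , 𝕦) ∷ Δ) ∷ [])
  ∨L   : ∀ Γ Δ φ ψ → Rule ((φ ∨' ψ , 𝕦) ∷ Γ ⟹ Δ)
                          (((φ , 𝕦) ∷ Γ ⟹ Δ) ∷ ((ψ , 𝕦) ∷ Γ ⟹ Δ) ∷ [])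
  ∨R   : ∀ Γ Δ φ ψ → Rule (Γ ⟹ (φ ∨' ψ , 𝕦) ∷ Δ) [ Γ ⟹ (φ , 𝕦) ∷ (ψ , 𝕦) ∷ Δ ]
  ⇒L   : ∀ Γ Δ φ ψ → Rule ((φ ⇒' ψ , 𝕦) ∷ Γ ⟹ Δ)
                          ((Γ ⟹ (φ , 𝕦) ∷ Δ) ∷ ((ψ , 𝕦) ∷ Γ ⟹ Δ) ∷ [])
  ⇒R   : ∀ Γ Δ φ ψ → Rule (Γ ⟹ (φ ⇒' ψ , 𝕦) ∷ Δ) [ (φ , 𝕦) ∷ Γ ⟹ (ψ , 𝕦) ∷ [] ]
  u    : ∀ Γ Δ φ → Rule (Γ ⟹ (φ , 𝕗) ∷ Δ) [ Γ ⟹ (φ , 𝕦) ∷ Δ ]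
  f    : ∀ Γ Δ φ → Rule (Γ ⟹ (φ , 𝕦) ∷ Δ) [ Γ ⟹ (φ , 𝕗) ∷ Δ ]
  T    : ∀ a Γ Δ φ → Rule ((K a φ , 𝕦) ∷ Γ ⟹ Δ) [ (φ , 𝕦) ∷ Γ ⟹ Δ ]
  S5   : ∀ a Π Γ Δ Σ φ x → Rule (Π ++ Kl a Γ ⟹ (K a φ , x) ∷ Kl a Δ ++ Σ)
                                 [ Kl a Γ ⟹ (φ , x) ∷ Kl a Δ ]
  K⇒   : ∀ a Γ Δ φ ψ → Rule (Γ ⟹ (K a φ ⇒' ψ , 𝕦) ∷ Δ)
                            [ (K a φ , 𝕦) ∷ Γ ⟹ (ψ , 𝕦) ∷ Δ ]
  CL   : ∀ Γ Δ φ → Rule ((C φ , 𝕦) ∷ Γ ⟹ Δ)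
                        [ (φ , 𝕦) ∷ map (λ a → (K a (C φ) , 𝕦)) (allFin m) ++ Γ ⟹ Δ ]
  CR   : ∀ Γ Δ φ x → Rule (Γ ⟹ (C φ , x) ∷ Δ)
                          ((Γ ⟹ (φ , 𝕦) ∷ Δ) ∷ map (λ a → Γ ⟹ (K a (C φ) , x) ∷ Δ) (allFin m))
  cut  : ∀ Γ Δ φ → Rule (Γ ⟹ Δ) (((φ , 𝕦) ∷ Γ ⟹ Δ) ∷ (Γ ⟹ (φ , 𝕦) ∷ Δ) ∷ [])

crFocused : ∀ {m} {c : Seq m} {ps} → Rule c ps → Bool
crFocused (CR _ _ _ 𝕗) = true
crFocused _            = false

-- A history is the list of ancestors (nearest first) of the current node,
-- each with its sequent and whether the rule applied there is a CR instance
-- with focused principal formula.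

History : ℕ → Set
History m = List (Seq m × Bool)

-- the current node v (with sequent s) is the upper node of a successful
-- repetition (u , v): u is a proper ancestor with identical sequent, every
-- sequent on the path u..v has a focused formula, and the path passes a
-- CR instance with focused principal formula.
SuccessfulRepetition : ∀ {m} → History m → Seq m → Set
SuccessfulRepetition H s =
  ∃ λ pre → ∃ λ e → ∃ λ rest →
    (H ≡ pre ++ e ∷ rest) ×
    (proj₁ e ≈ₛ s) ×
    HasFocus s ×
    All (λ e' → HasFocus (proj₁ e')) (pre ++ [ e ]) ×
    Any (λ e' → proj₂ e' ≡ true) (pre ++ [ e ])

data CProof {m} (Good : Seq m → Set) : History m → Seq m → Set where
  rule   : ∀ {H s c ps} → IsSequent s → Good s →
           (r : Rule c ps) → s ≈ₛ c →
           All (CProof Good ((s , crFocused r) ∷ H)) ps → CProof Good H s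
  repeat : ∀ {H s} → IsSequent s → Good s →
           SuccessfulRepetition H s → CProof Good H s

data Cl {m} (B : List (Fm m)) : Fm m → Set where
  base : ∀ {φ} → φ ∈ B → Cl B φ
  ∧₁ : ∀ {φ ψ} → Cl B (φ ∧' ψ) → Cl B φ
  ∧₂ : ∀ {φ ψ} → Cl B (φ ∧' ψ) → Cl B ψ
  ∨₁ : ∀ {φ ψ} → Cl B (φ ∨' ψ) → Cl B φ
  ∨₂ : ∀ {φ ψ} → Cl B (φ ∨' ψ) → Cl B ψ
  ⇒₁ : ∀ {φ ψ} → Cl B (φ ⇒' ψ) → Cl B φ
  ⇒₂ : ∀ {φ ψ} → Cl B (φ ⇒' ψ) → Cl B ψ
  K₁ : ∀ {a φ} → Cl B (K a φ) → Cl B φ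
  K¬ : ∀ {a φ} → Cl B (K a φ) → Cl B (¬' (K a φ))
  C₁ : ∀ {φ} → Cl B (C φ) → Cl B φ
  CK : ∀ {a φ} → Cl B (C φ) → Cl B (K a (C φ))

formulasOf : ∀ {m} → Seq m → List (Fm m)
formulasOf s = underlying (lhs s) ++ underlying (rhs s)

InClosureOf : ∀ {m} → Seq m → Seq m → Set
InClosureOf σ s = All (Cl (formulasOf σ)) (formulasOf s)

module Submission where

-- Completeness by elimination of bad worlds, with every cut analytic.  Let L list the negation
-- closure of σ.  A world puts each position of L on the left or on the right; cutting a sequent
-- on every formula of L leaves at each leaf the sequent of one world.  A world is bad if a rule
-- decomposing one of its formulas closes all premises by axioms, or if a formula on its right
-- has no witness among the worlds not yet found bad: for φ ⇒ ψ and K_a φ every candidate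
-- successor is bad, and for C φ a set of worlds closed under non-bad a-neighbours keeps φ on the
-- left.  The sequent of a bad world has a cyclic proof, by induction on the round in which it
-- is eliminated; for C φ the proof explores that set with C φ in focus and closes a revisited
-- world by a successful repetition.  There are finitely many worlds, so elimination stabilises,
-- and the surviving worlds, ordered by inclusion of their left sides and a-related when they
-- agree on K_a-formulas, form an S5 countermodel satisfying a truth lemma.  Hence every leaf of
-- the cut tree of a valid σ is an axiom or a bad world.

open import Defs
open import Data.Nat as ℕ using (ℕ; zero; suc; _+_; _≤_; _<_; z≤n; s≤s)
import Data.Nat.Properties as ℕ
open import Data.Nat.Induction using (<-wellFounded)
open import Data.Bool as Bool using (Bool; true; false; not)
import Data.Bool.Properties as Bool
open import Data.Empty using (⊥; ⊥-elim)
open import Data.Unit using (⊤; tt)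
open import Data.Fin as Fin using (Fin; zero; suc)
import Data.Fin.Properties as Fin
open import Data.Product using (∃; _×_; _,_; proj₁; proj₂)
open import Data.Sum using (_⊎_; inj₁; inj₂; [_,_]′)
open import Data.Vec as Vec using (Vec; []; _∷_)
open import Data.Vec.Properties using (≡-dec)
open import Data.Vec.Relation.Binary.Pointwise.Extensional as Pointwise using (Pointwise; Pointwise-≡⇒≡)
open import Data.List
  using (List; []; _∷_; [_]; _++_; length; lookup; map; allFin; concatMap; filter; cartesianProductWith)
import Data.List.Properties as List
open import Data.List.Membership.Propositional using (_∈_; find; lose)
open import Data.List.Membership.Propositional.Properties
  using (∈-++⁺ˡ; ∈-++⁺ʳ; ∈-++⁻; ∈-map⁺; ∈-map⁻; ∈-allFin; ∈-lookup; ∈-concatMap⁺; ∈-concatMap⁻;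
         ∈-cartesianProductWith⁺)
open import Data.List.Relation.Unary.Any as Any using (Any; here; there)
import Data.List.Relation.Unary.Any.Properties as Anyₚ
open import Data.List.Relation.Unary.All as All using (All; []; _∷_)
import Data.List.Relation.Unary.All.Properties as Allₚ
open import Function using (_∘_)
open import Induction.WellFounded using (Acc; acc)
open import Relation.Binary.Definitions using (DecidableEquality)
open import Relation.Binary.PropositionalEquality using (_≡_; refl; sym; trans; subst; cong)
open import Relation.Binary.Construct.Closure.ReflexiveTransitive using (Star; ε; _◅_)
open import Relation.Nullary using (¬_; Dec; yes; no; ¬?)
open import Relation.Nullary.Decidable
  using (map′; _×-dec_; _⊎-dec_; _→-dec_; decidable-stable; ¬¬-excluded-middle; isYes; toWitness; fromWitness)
open import Relation.Unary using (Decidable)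

infix 4 _≟ᶠ_

_≟ᶠ_ : ∀ {m} → DecidableEquality (Fm m)
⊥' ≟ᶠ ⊥' = yes refl
atom p ≟ᶠ atom q = map′ (cong atom) (λ { refl → refl }) (p ℕ.≟ q)
(φ ∧' ψ) ≟ᶠ (φ₁ ∧' ψ₁) = map′ (λ { (refl , refl) → refl }) (λ { refl → refl , refl }) (φ ≟ᶠ φ₁ ×-dec ψ ≟ᶠ ψ₁)
(φ ∨' ψ) ≟ᶠ (φ₁ ∨' ψ₁) = map′ (λ { (refl , refl) → refl }) (λ { refl → refl , refl }) (φ ≟ᶠ φ₁ ×-dec ψ ≟ᶠ ψ₁)
(φ ⇒' ψ) ≟ᶠ (φ₁ ⇒' ψ₁) = map′ (λ { (refl , refl) → refl }) (λ { refl → refl , refl }) (φ ≟ᶠ φ₁ ×-dec ψ ≟ᶠ ψ₁)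
K a φ ≟ᶠ K b ψ = map′ (λ { (refl , refl) → refl }) (λ { refl → refl , refl }) (a Fin.≟ b ×-dec φ ≟ᶠ ψ)
C φ ≟ᶠ C ψ = map′ (cong C) (λ { refl → refl }) (φ ≟ᶠ ψ)
⊥' ≟ᶠ atom _ = no λ ()
⊥' ≟ᶠ (_ ∧' _) = no λ ()
⊥' ≟ᶠ (_ ∨' _) = no λ ()
⊥' ≟ᶠ (_ ⇒' _) = no λ ()
⊥' ≟ᶠ K _ _ = no λ ()
⊥' ≟ᶠ C _ = no λ ()
atom _ ≟ᶠ ⊥' = no λ ()
atom _ ≟ᶠ (_ ∧' _) = no λ ()
atom _ ≟ᶠ (_ ∨' _) = no λ ()
atom _ ≟ᶠ (_ ⇒' _) = no λ ()
atom _ ≟ᶠ K _ _ = no λ ()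
atom _ ≟ᶠ C _ = no λ ()
(_ ∧' _) ≟ᶠ ⊥' = no λ ()
(_ ∧' _) ≟ᶠ atom _ = no λ ()
(_ ∧' _) ≟ᶠ (_ ∨' _) = no λ ()
(_ ∧' _) ≟ᶠ (_ ⇒' _) = no λ ()
(_ ∧' _) ≟ᶠ K _ _ = no λ ()
(_ ∧' _) ≟ᶠ C _ = no λ ()
(_ ∨' _) ≟ᶠ ⊥' = no λ ()
(_ ∨' _) ≟ᶠ atom _ = no λ ()
(_ ∨' _) ≟ᶠ (_ ∧' _) = no λ ()
(_ ∨' _) ≟ᶠ (_ ⇒' _) = no λ ()
(_ ∨' _) ≟ᶠ K _ _ = no λ ()
(_ ∨' _) ≟ᶠ C _ = no λ ()
(_ ⇒' _) ≟ᶠ ⊥' = no λ ()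
(_ ⇒' _) ≟ᶠ atom _ = no λ ()
(_ ⇒' _) ≟ᶠ (_ ∧' _) = no λ ()
(_ ⇒' _) ≟ᶠ (_ ∨' _) = no λ ()
(_ ⇒' _) ≟ᶠ K _ _ = no λ ()
(_ ⇒' _) ≟ᶠ C _ = no λ ()
K _ _ ≟ᶠ ⊥' = no λ ()
K _ _ ≟ᶠ atom _ = no λ ()
K _ _ ≟ᶠ (_ ∧' _) = no λ ()
K _ _ ≟ᶠ (_ ∨' _) = no λ ()
K _ _ ≟ᶠ (_ ⇒' _) = no λ ()
K _ _ ≟ᶠ C _ = no λ ()
C _ ≟ᶠ ⊥' = no λ ()
C _ ≟ᶠ atom _ = no λ ()
C _ ≟ᶠ (_ ∧' _) = no λ ()
C _ ≟ᶠ (_ ∨' _) = no λ ()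
C _ ≟ᶠ (_ ⇒' _) = no λ ()
C _ ≟ᶠ K _ _ = no λ ()

module _ {m : ℕ} where

  ComponentsIn : List (Fm m) → Fm m → Set
  ComponentsIn xs (φ ∧' ψ) = φ ∈ xs × ψ ∈ xs
  ComponentsIn xs (φ ∨' ψ) = φ ∈ xs × ψ ∈ xs
  ComponentsIn xs (φ ⇒' ψ) = φ ∈ xs × ψ ∈ xs
  ComponentsIn xs (K a φ) = φ ∈ xs × ¬' (K a φ) ∈ xs
  ComponentsIn xs (C φ) = φ ∈ xs × (∀ a → K a (C φ) ∈ xs)
  ComponentsIn xs _ = ⊤

  Saturated : List (Fm m) → Set
  Saturated xs = ∀ {φ} → φ ∈ xs → ComponentsIn xs φ

  ComponentsIn-mono : ∀ {xs ys} → (∀ {χ} → χ ∈ xs → χ ∈ ys) → ∀ φ → ComponentsIn xs φ → ComponentsIn ys φ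
  ComponentsIn-mono ⊆ ⊥' _ = tt
  ComponentsIn-mono ⊆ (atom _) _ = tt
  ComponentsIn-mono ⊆ (_ ∧' _) (p , q) = ⊆ p , ⊆ q
  ComponentsIn-mono ⊆ (_ ∨' _) (p , q) = ⊆ p , ⊆ q
  ComponentsIn-mono ⊆ (_ ⇒' _) (p , q) = ⊆ p , ⊆ q
  ComponentsIn-mono ⊆ (K _ _) (p , q) = ⊆ p , ⊆ q
  ComponentsIn-mono ⊆ (C _) (p , q) = ⊆ p , λ a → ⊆ (q a)

  saturated-++ : ∀ {xs ys} → Saturated xs → Saturated ys → Saturated (xs ++ ys)
  saturated-++ {xs} {ys} sat-xs sat-ys {φ} φ∈ with ∈-++⁻ xs φ∈
  ... | inj₁ φ∈xs = ComponentsIn-mono ∈-++⁺ˡ φ (sat-xs φ∈xs)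
  ... | inj₂ φ∈ys = ComponentsIn-mono (∈-++⁺ʳ xs) φ (sat-ys φ∈ys)

  saturated-concatMap : ∀ (g : Fm m → List (Fm m)) → (∀ φ → Saturated (g φ)) → ∀ xs → Saturated (concatMap g xs)
  saturated-concatMap g sat xs {ψ} ψ∈ with find (∈-concatMap⁻ g {xs = xs} ψ∈)
  ... | φ , φ∈xs , ψ∈gφ = ComponentsIn-mono (λ χ∈ → ∈-concatMap⁺ g (Any.map (λ { refl → χ∈ }) φ∈xs)) ψ (sat φ ψ∈gφ)

  knowsC : Fm m → Fin m → List (Fm m)
  knowsC φ a = K a (C φ) ∷ ¬' (K a (C φ)) ∷ []

  knowsC-all : Fm m → List (Fm m)
  knowsC-all φ = concatMap (knowsC φ) (allFin m)

  closure : Fm m → List (Fm m)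
  closure ⊥' = ⊥' ∷ []
  closure (atom p) = atom p ∷ []
  closure (φ ∧' ψ) = φ ∧' ψ ∷ closure φ ++ closure ψ
  closure (φ ∨' ψ) = φ ∨' ψ ∷ closure φ ++ closure ψ
  closure (φ ⇒' ψ) = φ ⇒' ψ ∷ closure φ ++ closure ψ
  closure (K a φ) = K a φ ∷ ¬' (K a φ) ∷ ⊥' ∷ closure φ
  closure (C φ) = C φ ∷ ⊥' ∷ knowsC-all φ ++ closure φ

  ∈-closure : ∀ φ → φ ∈ closure φ
  ∈-closure ⊥' = here refl
  ∈-closure (atom _) = here refl
  ∈-closure (_ ∧' _) = here refl
  ∈-closure (_ ∨' _) = here refl
  ∈-closure (_ ⇒' _) = here refl
  ∈-closure (K _ _) = here refl
  ∈-closure (C _) = here refl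

  K∈knowsC-all : ∀ φ a → K a (C φ) ∈ knowsC-all φ
  K∈knowsC-all φ a = ∈-concatMap⁺ (knowsC φ) (Any.map (λ { refl → here refl }) (∈-allFin a))

  ¬K∈knowsC-all : ∀ φ a → ¬' (K a (C φ)) ∈ knowsC-all φ
  ¬K∈knowsC-all φ a = ∈-concatMap⁺ (knowsC φ) (Any.map (λ { refl → there (here refl) }) (∈-allFin a))

  closure-saturated : ∀ φ → Saturated (closure φ)
  closure-saturated ⊥' (here refl) = tt
  closure-saturated (atom _) (here refl) = tt
  closure-saturated (φ ∧' ψ) (here refl) = there (∈-++⁺ˡ (∈-closure φ)) , there (∈-++⁺ʳ _ (∈-closure ψ))
  closure-saturated (φ ∧' ψ) {χ} (there p) =
    ComponentsIn-mono there χ (saturated-++ (closure-saturated φ) (closure-saturated ψ) p)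
  closure-saturated (φ ∨' ψ) (here refl) = there (∈-++⁺ˡ (∈-closure φ)) , there (∈-++⁺ʳ _ (∈-closure ψ))
  closure-saturated (φ ∨' ψ) {χ} (there p) =
    ComponentsIn-mono there χ (saturated-++ (closure-saturated φ) (closure-saturated ψ) p)
  closure-saturated (φ ⇒' ψ) (here refl) = there (∈-++⁺ˡ (∈-closure φ)) , there (∈-++⁺ʳ _ (∈-closure ψ))
  closure-saturated (φ ⇒' ψ) {χ} (there p) =
    ComponentsIn-mono there χ (saturated-++ (closure-saturated φ) (closure-saturated ψ) p)
  closure-saturated (K a φ) (here refl) = there (there (there (∈-closure φ))) , there (here refl)
  closure-saturated (K a φ) (there (here refl)) = here refl , there (there (here refl))
  closure-saturated (K a φ) (there (there (here refl))) = tt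
  closure-saturated (K a φ) {χ} (there (there (there p))) =
    ComponentsIn-mono (λ q → there (there (there q))) χ (closure-saturated φ p)
  closure-saturated (C φ) (here refl) =
    there (there (∈-++⁺ʳ _ (∈-closure φ))) , λ a → there (there (∈-++⁺ˡ (K∈knowsC-all φ a)))
  closure-saturated (C φ) (there (here refl)) = tt
  closure-saturated (C φ) {χ} (there (there p)) with ∈-++⁻ (knowsC-all φ) p
  ... | inj₂ q = ComponentsIn-mono (λ r → there (there (∈-++⁺ʳ _ r))) χ (closure-saturated φ q)
  ... | inj₁ q with find (∈-concatMap⁻ (knowsC φ) {xs = allFin m} q)
  ...   | a , _ , here refl = here refl , there (there (∈-++⁺ˡ (¬K∈knowsC-all φ a)))
  ...   | a , _ , there (here refl) = there (there (∈-++⁺ˡ (K∈knowsC-all φ a))) , there (here refl)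

  closureOf : List (Fm m) → List (Fm m)
  closureOf = concatMap closure

  closureOf-saturated : ∀ xs → Saturated (closureOf xs)
  closureOf-saturated = saturated-concatMap closure closure-saturated

  ∈-closureOf : ∀ {φ xs} → φ ∈ xs → φ ∈ closureOf xs
  ∈-closureOf {φ} φ∈xs = ∈-concatMap⁺ closure (Any.map (λ { refl → ∈-closure φ }) φ∈xs)

module _ {n : ℕ} {B : List (Fm (suc n))} where

  closure⊆Cl : ∀ {φ ψ} → Cl B φ → ψ ∈ closure φ → Cl B ψ
  closure⊆Cl {⊥'} c (here refl) = c
  closure⊆Cl {atom _} c (here refl) = c
  closure⊆Cl {_ ∧' _} c (here refl) = c
  closure⊆Cl {φ ∧' _} c (there p) with ∈-++⁻ (closure φ) p
  ... | inj₁ q = closure⊆Cl (∧₁ c) q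
  ... | inj₂ q = closure⊆Cl (∧₂ c) q
  closure⊆Cl {_ ∨' _} c (here refl) = c
  closure⊆Cl {φ ∨' _} c (there p) with ∈-++⁻ (closure φ) p
  ... | inj₁ q = closure⊆Cl (∨₁ c) q
  ... | inj₂ q = closure⊆Cl (∨₂ c) q
  closure⊆Cl {_ ⇒' _} c (here refl) = c
  closure⊆Cl {φ ⇒' _} c (there p) with ∈-++⁻ (closure φ) p
  ... | inj₁ q = closure⊆Cl (⇒₁ c) q
  ... | inj₂ q = closure⊆Cl (⇒₂ c) q
  closure⊆Cl {K _ _} c (here refl) = c
  closure⊆Cl {K _ _} c (there (here refl)) = K¬ c
  closure⊆Cl {K _ _} c (there (there (here refl))) = ⇒₂ (K¬ c)
  closure⊆Cl {K _ _} c (there (there (there p))) = closure⊆Cl (K₁ c) p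
  closure⊆Cl {C _} c (here refl) = c
  closure⊆Cl {C _} c (there (here refl)) = ⇒₂ (K¬ (CK {a = Fin.zero} c))
  closure⊆Cl {C φ} c (there (there p)) with ∈-++⁻ (knowsC-all φ) p
  ... | inj₂ q = closure⊆Cl (C₁ c) q
  ... | inj₁ q with find (∈-concatMap⁻ (knowsC φ) {xs = allFin (suc n)} q)
  ...   | _ , _ , here refl = CK c
  ...   | _ , _ , there (here refl) = K¬ (CK c)

  closureOf⊆Cl : ∀ {xs ψ} → (∀ {φ} → φ ∈ xs → Cl B φ) → ψ ∈ closureOf xs → Cl B ψ
  closureOf⊆Cl {xs} base-xs ψ∈ with find (∈-concatMap⁻ closure {xs = xs} ψ∈)
  ... | _ , φ∈xs , ψ∈ = closure⊆Cl (base-xs φ∈xs) ψ∈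

module _ {A : Set} {P Q : A → Set} (P? : Decidable P) (Q? : Decidable Q) (P⊆Q : ∀ {x} → P x → Q x) where

  filter-length-mono : ∀ xs → length (filter P? xs) ≤ length (filter Q? xs)
  filter-length-mono [] = z≤n
  filter-length-mono (x ∷ xs) with P? x | Q? x
  ... | yes _ | yes _ = s≤s (filter-length-mono xs)
  ... | yes p | no ¬q = ⊥-elim (¬q (P⊆Q p))
  ... | no _ | yes _ = ℕ.m≤n⇒m≤1+n (filter-length-mono xs)
  ... | no _ | no _ = filter-length-mono xs

  filter-length-strict : ∀ {x xs} → x ∈ xs → ¬ P x → Q x → length (filter P? xs) < length (filter Q? xs)
  filter-length-strict {xs = y ∷ ys} (here refl) ¬p q with P? y | Q? y
  ... | yes p | _ = ⊥-elim (¬p p)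
  ... | no _ | yes _ = s≤s (filter-length-mono ys)
  ... | no _ | no ¬q = ⊥-elim (¬q q)
  filter-length-strict {xs = y ∷ ys} (there x∈) ¬p q with P? y | Q? y
  ... | yes _ | yes _ = s≤s (filter-length-strict x∈ ¬p q)
  ... | yes p | no ¬q = ⊥-elim (¬q (P⊆Q p))
  ... | no _ | yes _ = ℕ.m≤n⇒m≤1+n (filter-length-strict x∈ ¬p q)
  ... | no _ | no _ = filter-length-strict x∈ ¬p q

module Enumeration {A : Set} (xs : List A) (enumerates : ∀ x → x ∈ xs) where

  ∀? : ∀ {P : A → Set} → Decidable P → Dec (∀ x → P x)
  ∀? P? = map′ (λ all x → All.lookup all (enumerates x)) (λ all → All.tabulate λ {x} _ → all x) (All.all? P? xs)

  ∃? : ∀ {P : A → Set} → Decidable P → Dec (∃ P)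
  ∃? P? = map′ Any.satisfied (λ (x , px) → lose (enumerates x) px) (Any.any? P? xs)

  all-or-counterexample : ∀ {P : A → Set} → Decidable P → (∀ x → P x) ⊎ ∃ (¬_ ∘ P)
  all-or-counterexample P? with Any.any? (¬? ∘ P?) xs
  ... | yes some = inj₂ (Any.satisfied some)
  ... | no none = inj₁ λ x → decidable-stable (P? x) (λ ¬px → none (lose (enumerates x) ¬px))

  ¬¬-decidable : ∀ (P : A → Set) → ¬ ¬ (∀ x → Dec (P x))
  ¬¬-decidable P k = on xs λ dec → k (λ x → dec (enumerates x))
    where
      on : ∀ ys → ¬ ¬ (∀ {x} → x ∈ ys → Dec (P x))
      on [] k = k λ ()
      on (y ∷ ys) k = ¬¬-excluded-middle λ dy → on ys λ dys → k λ { (here refl) → dy ; (there p) → dys p }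

  count : ∀ {P : A → Set} → Decidable P → ℕ
  count P? = length (filter P? xs)

  count≤size : ∀ {P : A → Set} (P? : Decidable P) → count P? ≤ length xs
  count≤size P? = List.length-filter P? xs

  count-strict : ∀ {P Q : A → Set} (P? : Decidable P) (Q? : Decidable Q) → (∀ {x} → P x → Q x) →
                 ∀ x → ¬ P x → Q x → count P? < count Q?
  count-strict P? Q? P⊆Q x = filter-length-strict P? Q? P⊆Q (enumerates x)

  module _ {P : ℕ → A → Set} (P? : ∀ k → Decidable (P k)) (P-mono : ∀ {k x} → P k x → P (suc k) x) where

    Stable : ℕ → Set
    Stable k = ∀ x → P (suc k) x → P k x

    stable-or-grows : ∀ k → Stable k ⊎ count (P? k) < count (P? (suc k))
    stable-or-grows k with all-or-counterexample (λ x → P? (suc k) x →-dec P? k x)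
    ... | inj₁ stable = inj₁ stable
    ... | inj₂ (x , ¬stable) with P? (suc k) x | P? k x
    ...   | _ | yes pk = ⊥-elim (¬stable λ _ → pk)
    ...   | no ¬pk+1 | no _ = ⊥-elim (¬stable λ pk+1 → ⊥-elim (¬pk+1 pk+1))
    ...   | yes pk+1 | no ¬pk = inj₂ (count-strict (P? k) (P? (suc k)) P-mono x ¬pk pk+1)

    stabilises : ∃ Stable
    stabilises = search (suc (length xs)) 0 z≤n (ℕ.≤-reflexive (sym (ℕ.+-identityʳ (suc (length xs)))))
      where
        search : ∀ fuel k → k ≤ count (P? k) → length xs < fuel + k → ∃ Stable
        search zero k k≤count size<k = ⊥-elim (ℕ.<⇒≱ size<k (ℕ.≤-trans k≤count (count≤size (P? k))))
        search (suc fuel) k k≤count size< with stable-or-grows k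
        ... | inj₁ stable = k , stable
        ... | inj₂ grows =
          search fuel (suc k) (ℕ.≤-trans (s≤s k≤count) grows) (ℕ.≤-trans size< (ℕ.≤-reflexive (sym (ℕ.+-suc fuel k))))

∈-Bool : ∀ b → b ∈ true ∷ false ∷ []
∈-Bool true = here refl
∈-Bool false = there (here refl)

allVecs : ∀ k → List (Vec Bool k)
allVecs zero = [] ∷ []
allVecs (suc k) = cartesianProductWith _∷_ (true ∷ false ∷ []) (allVecs k)

∈-allVecs : ∀ {k} (v : Vec Bool k) → v ∈ allVecs k
∈-allVecs [] = here refl
∈-allVecs (b ∷ v) = ∈-cartesianProductWith⁺ _∷_ (∈-Bool b) (∈-allVecs v)

-- Tabulated predicates on Vec Bool k: being enumerable, they make the existential in NoWitness
-- for C decidable.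
Trie : ℕ → Set
Trie zero = Bool
Trie (suc k) = Trie k × Trie k

infixl 5 _!_

_!_ : ∀ {k} → Trie k → Vec Bool k → Bool
b ! [] = b
(l , r) ! (true ∷ v) = l ! v
(l , r) ! (false ∷ v) = r ! v

tabulate : ∀ {k} → (Vec Bool k → Bool) → Trie k
tabulate {zero} g = g []
tabulate {suc k} g = tabulate (g ∘ (true ∷_)) , tabulate (g ∘ (false ∷_))

tabulate-! : ∀ {k} (g : Vec Bool k → Bool) v → tabulate g ! v ≡ g v
tabulate-! g [] = refl
tabulate-! g (true ∷ v) = tabulate-! (g ∘ (true ∷_)) v
tabulate-! g (false ∷ v) = tabulate-! (g ∘ (false ∷_)) v

allTries : ∀ k → List (Trie k)
allTries zero = true ∷ false ∷ []
allTries (suc k) = cartesianProductWith _,_ (allTries k) (allTries k)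

∈-allTries : ∀ {k} (S : Trie k) → S ∈ allTries k
∈-allTries {zero} b = ∈-Bool b
∈-allTries {suc k} (l , r) = ∈-cartesianProductWith⁺ _,_ (∈-allTries l) (∈-allTries r)

module _ {A : Set} where

  ≋-refl : ∀ {xs : List A} → xs ≋ xs
  ≋-refl _ = (λ p → p) , (λ p → p)

  ≋-sym : ∀ {xs ys : List A} → xs ≋ ys → ys ≋ xs
  ≋-sym eq x = proj₂ (eq x) , proj₁ (eq x)

  ≋-trans : ∀ {xs ys zs : List A} → xs ≋ ys → ys ≋ zs → xs ≋ zs
  ≋-trans eq eq′ x = (λ p → proj₁ (eq′ x) (proj₁ (eq x) p)) , (λ p → proj₂ (eq x) (proj₂ (eq′ x) p))

  ≋-∷ : ∀ {x} {xs : List A} → x ∈ xs → xs ≋ (x ∷ xs)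
  ≋-∷ x∈xs _ = there , λ { (here refl) → x∈xs ; (there p) → p }

  ≋-∷⁺ : ∀ {x} {xs ys : List A} → xs ≋ ys → (x ∷ xs) ≋ (x ∷ ys)
  ≋-∷⁺ eq _ = (λ { (here refl) → here refl ; (there p) → there (proj₁ (eq _) p) })
            , (λ { (here refl) → here refl ; (there p) → there (proj₂ (eq _) p) })

module _ {A : Set} {xs ys : List A} (ys⊆xs : ∀ {y} → y ∈ ys → y ∈ xs) where

  ≋-absorbˡ : xs ≋ (ys ++ xs)
  ≋-absorbˡ _ = ∈-++⁺ʳ ys , λ p → [ ys⊆xs , (λ q → q) ]′ (∈-++⁻ ys p)

  ≋-absorbʳ : xs ≋ (xs ++ ys)
  ≋-absorbʳ _ = ∈-++⁺ˡ , λ p → [ (λ q → q) , ys⊆xs ]′ (∈-++⁻ xs p)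

module _ {m : ℕ} where

  ≈ₛ-sym : ∀ {s t : Seq m} → s ≈ₛ t → t ≈ₛ s
  ≈ₛ-sym (l , r) = ≋-sym l , ≋-sym r

  ≈ₛ-trans : ∀ {s t u : Seq m} → s ≈ₛ t → t ≈ₛ u → s ≈ₛ u
  ≈ₛ-trans (l , r) (l′ , r′) = ≋-trans l l′ , ≋-trans r r′

  module _ {G G′ : Seq m → Set} (G⊆G′ : ∀ {s} → G s → G′ s) where

    CProof-mono : ∀ {H s} → CProof G H s → CProof G′ H s
    CProof-mono-all : ∀ {H ss} → All (CProof G H) ss → All (CProof G′ H) ss

    CProof-mono (rule seq g r eq ps) = rule seq (G⊆G′ g) r eq (CProof-mono-all ps)
    CProof-mono (repeat seq g rep) = repeat seq (G⊆G′ g) rep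

    CProof-mono-all [] = []
    CProof-mono-all (p ∷ ps) = CProof-mono p ∷ CProof-mono-all ps

  Unfocused : List (AF m) → Set
  Unfocused Δ = ∀ {φ x} → (φ , x) ∈ Δ → x ≡ 𝕦

  focused? : ∀ (Δ : List (AF m)) → (∃ λ ψ → (ψ , 𝕗) ∈ Δ) ⊎ Unfocused Δ
  focused? [] = inj₂ λ ()
  focused? ((ψ , 𝕗) ∷ Δ) = inj₁ (ψ , here refl)
  focused? ((ψ , 𝕦) ∷ Δ) with focused? Δ
  ... | inj₁ (χ , p) = inj₁ (χ , there p)
  ... | inj₂ unf = inj₂ λ { (here refl) → refl ; (there p) → unf p }

  part : Bool → Seq m → List (AF m)
  part true = lhs
  part false = rhs

  insert : Bool → Fm m → Seq m → Seq m
  insert true φ (Γ ⟹ Δ) = (φ , 𝕦) ∷ Γ ⟹ Δ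
  insert false φ (Γ ⟹ Δ) = Γ ⟹ (φ , 𝕦) ∷ Δ

  ∈-insert : ∀ b φ s → (φ , 𝕦) ∈ part b (insert b φ s)
  ∈-insert true φ s = here refl
  ∈-insert false φ s = here refl

  ∈-insert⁺ : ∀ b c φ s {y} → y ∈ part c s → y ∈ part c (insert b φ s)
  ∈-insert⁺ true true φ s p = there p
  ∈-insert⁺ true false φ s p = p
  ∈-insert⁺ false true φ s p = p
  ∈-insert⁺ false false φ s p = there p

  ∈-insert⁻ : ∀ b c φ s {y} → y ∈ part c (insert b φ s) → (b ≡ c × y ≡ (φ , 𝕦)) ⊎ y ∈ part c s
  ∈-insert⁻ true true φ s (here refl) = inj₁ (refl , refl)
  ∈-insert⁻ true true φ s (there p) = inj₂ p
  ∈-insert⁻ true false φ s p = inj₂ p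
  ∈-insert⁻ false true φ s p = inj₂ p
  ∈-insert⁻ false false φ s (here refl) = inj₁ (refl , refl)
  ∈-insert⁻ false false φ s (there p) = inj₂ p

  HasFocus-insert : ∀ b {φ} {s} → HasFocus s → HasFocus (insert b φ s)
  HasFocus-insert true foc = foc
  HasFocus-insert false (ψ , p) = ψ , there p

  cutLeaf : (xs : List (Fm m)) → Vec Bool (length xs) → Seq m → Seq m
  cutLeaf [] [] s = s
  cutLeaf (x ∷ xs) (b ∷ bs) s = cutLeaf xs bs (insert b x s)

  ∈-cutLeaf⁺ˡ : ∀ xs bs c s {y} → y ∈ part c s → y ∈ part c (cutLeaf xs bs s)
  ∈-cutLeaf⁺ˡ [] [] c s p = p
  ∈-cutLeaf⁺ˡ (x ∷ xs) (b ∷ bs) c s p = ∈-cutLeaf⁺ˡ xs bs c (insert b x s) (∈-insert⁺ b c x s p)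

  ∈-cutLeaf⁺ʳ : ∀ xs bs s i → (lookup xs i , 𝕦) ∈ part (Vec.lookup bs i) (cutLeaf xs bs s)
  ∈-cutLeaf⁺ʳ (x ∷ xs) (b ∷ bs) s zero = ∈-cutLeaf⁺ˡ xs bs b (insert b x s) (∈-insert b x s)
  ∈-cutLeaf⁺ʳ (x ∷ xs) (b ∷ bs) s (suc i) = ∈-cutLeaf⁺ʳ xs bs (insert b x s) i

  ∈-cutLeaf⁻ : ∀ xs bs c s {y} → y ∈ part c (cutLeaf xs bs s) →
               y ∈ part c s ⊎ ∃ λ i → Vec.lookup bs i ≡ c × y ≡ (lookup xs i , 𝕦)
  ∈-cutLeaf⁻ [] [] c s p = inj₁ p
  ∈-cutLeaf⁻ (x ∷ xs) (b ∷ bs) c s p with ∈-cutLeaf⁻ xs bs c (insert b x s) p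
  ... | inj₂ (i , bᵢ≡c , refl) = inj₂ (suc i , bᵢ≡c , refl)
  ... | inj₁ q with ∈-insert⁻ b c x s q
  ...   | inj₁ (refl , refl) = inj₂ (zero , refl , refl)
  ...   | inj₂ r = inj₁ r

  IsSequent-extend : ∀ {s t} → IsSequent s →
                     (∀ b {φ x} → (φ , x) ∈ part b t → (φ , x) ∈ part b s ⊎ x ≡ 𝕦) → IsSequent t
  IsSequent-extend {s} {t} seq origin = record
    { lhs-unfocused = λ φ x p → unfocused (origin true p)
    ; rhs-atMostOne = λ φ ψ p q → IsSequent.rhs-atMostOne seq φ ψ (old (origin false p)) (old (origin false q))
    ; rhs-focusForm = λ φ p → IsSequent.rhs-focusForm seq φ (old (origin false p)) }
    where
      unfocused : ∀ {φ x} → (φ , x) ∈ lhs s ⊎ x ≡ 𝕦 → x ≡ 𝕦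
      unfocused (inj₁ p) = IsSequent.lhs-unfocused seq _ _ p
      unfocused (inj₂ x≡𝕦) = x≡𝕦
      old : ∀ {φ} → (φ , 𝕗) ∈ rhs s ⊎ 𝕗 ≡ 𝕦 → (φ , 𝕗) ∈ rhs s
      old (inj₁ p) = p

  IsSequent-focus : ∀ {s φ} → Focusable φ → IsSequent s → Unfocused (rhs s) → IsSequent (lhs s ⟹ (φ , 𝕗) ∷ rhs s)
  IsSequent-focus {s} foc seq unf = record
    { lhs-unfocused = IsSequent.lhs-unfocused seq
    ; rhs-atMostOne = λ { _ _ (here refl) (here refl) → refl ; _ _ (here refl) (there q) → absurd (unf q)
                        ; _ _ (there p) _ → absurd (unf p) }
    ; rhs-focusForm = λ { _ (here refl) → foc ; _ (there p) → absurd (unf p) } }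
    where
      absurd : ∀ {A : Set} → 𝕗 ≡ 𝕦 → A
      absurd ()

  IsSequent-empty : IsSequent {m} ([] ⟹ [])
  IsSequent-empty = record { lhs-unfocused = λ _ _ () ; rhs-atMostOne = λ _ _ () ; rhs-focusForm = λ _ () }

module _ {m : ℕ} (M : Model m) where
  open Model M using (W)

  ⊩-⋀ : ∀ {w : W} Γ → (∀ {φ x} → (φ , x) ∈ Γ → _⊩_ M w φ) → _⊩_ M w (⋀ (underlying Γ))
  ⊩-⋀ [] _ _ _ ⊥⊩ = ⊥⊩
  ⊩-⋀ (_ ∷ Γ) ⊩Γ = ⊩Γ (here refl) , ⊩-⋀ Γ (⊩Γ ∘ there)

  ⊩-⋁ : ∀ {w : W} Δ → _⊩_ M w (⋁ (underlying Δ)) → ∃ λ y → y ∈ Δ × _⊩_ M w (proj₁ y)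
  ⊩-⋁ (y ∷ _) (inj₁ ⊩y) = y , here refl , ⊩y
  ⊩-⋁ (_ ∷ Δ) (inj₂ ⊩Δ) with ⊩-⋁ Δ ⊩Δ
  ... | y , y∈ , ⊩y = y , there y∈ , ⊩y

module Canonical {n : ℕ} (L : List (Fm (suc n))) (L-saturated : Saturated L) where

  private
    m : ℕ
    m = suc n

  FormulasIn : Seq m → Set
  FormulasIn s = All (_∈ L) (formulasOf s)

  Proof : History m → Seq m → Set
  Proof = CProof FormulasIn

  record WellFormed (s : Seq m) : Set where
    field
      isSeq : IsSequent s
      ⊆L : ∀ b {φ x} → (φ , x) ∈ part b s → φ ∈ L
  open WellFormed

  formulasIn : ∀ {s} → WellFormed s → FormulasIn s
  formulasIn {s} wf = All.tabulate λ p → [ underlying⊆L true , underlying⊆L false ]′ (∈-++⁻ _ p)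
    where
      underlying⊆L : ∀ b {φ} → φ ∈ underlying (part b s) → φ ∈ L
      underlying⊆L b p with ∈-map⁻ proj₁ p
      ... | _ , q , refl = ⊆L wf b q

  node : ∀ {H s c ps} → WellFormed s → (r : Rule c ps) → s ≈ₛ c → All (Proof ((s , crFocused r) ∷ H)) ps → Proof H s
  node wf = rule (isSeq wf) (formulasIn wf)

  axiom : ∀ {H s φ x} → WellFormed s → (φ , 𝕦) ∈ lhs s → (φ , x) ∈ rhs s → Proof H s
  axiom {s = Γ ⟹ Δ} {φ} {x} wf l r = node wf (id Γ Δ φ x) (≋-∷ l , ≋-∷ r) []

  wf-extend : ∀ {s t} → WellFormed s →
              (∀ b {φ x} → (φ , x) ∈ part b t → (φ , x) ∈ part b s ⊎ (x ≡ 𝕦 × φ ∈ L)) → WellFormed t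
  wf-extend wf origin = record
    { isSeq = IsSequent-extend (isSeq wf) (λ b p → [ inj₁ , inj₂ ∘ proj₁ ]′ (origin b p))
    ; ⊆L = λ b p → [ ⊆L wf b , proj₂ ]′ (origin b p) }

  wf-empty : WellFormed ([] ⟹ [])
  wf-empty = record { isSeq = IsSequent-empty ; ⊆L = λ { true () ; false () } }

  wf-insert : ∀ b {φ s} → φ ∈ L → WellFormed s → WellFormed (insert b φ s)
  wf-insert b {φ} {s} φ∈L wf = wf-extend wf λ c p → case (∈-insert⁻ b c φ s p)
    where
      case : ∀ {c y} → (b ≡ c × y ≡ (φ , 𝕦)) ⊎ y ∈ part c s → y ∈ part c s ⊎ (proj₂ y ≡ 𝕦 × proj₁ y ∈ L)
      case (inj₁ (_ , refl)) = inj₂ (refl , φ∈L)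
      case (inj₂ q) = inj₁ q

  wf-focus : ∀ {s φ} → φ ∈ L → Focusable φ → Unfocused (rhs s) → WellFormed s → WellFormed (lhs s ⟹ (φ , 𝕗) ∷ rhs s)
  wf-focus φ∈L foc unf wf = record
    { isSeq = IsSequent-focus foc (isSeq wf) unf
    ; ⊆L = λ { true p → ⊆L wf true p ; false (here refl) → φ∈L ; false (there p) → ⊆L wf false p } }

  wf-cutLeaf : ∀ xs bs {s} → (∀ {x} → x ∈ xs → x ∈ L) → WellFormed s → WellFormed (cutLeaf xs bs s)
  wf-cutLeaf [] Vec.[] _ wf = wf
  wf-cutLeaf (x ∷ xs) (b Vec.∷ bs) xs⊆L wf = wf-cutLeaf xs bs (xs⊆L ∘ there) (wf-insert b (xs⊆L (here refl)) wf)

  LeavesProvable : List (Fm m) → Seq m → History m → Set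
  LeavesProvable xs s H =
    ∀ bs ext → (HasFocus s → All (HasFocus ∘ proj₁) ext) → Proof (ext ++ H) (cutLeaf xs bs s)

  cutOnAll : ∀ xs → (∀ {x} → x ∈ xs → x ∈ L) → ∀ {H s} → WellFormed s → LeavesProvable xs s H → Proof H s
  cutOnAll [] _ _ leaves = leaves Vec.[] [] (λ _ → [])
  cutOnAll (x ∷ xs) xs⊆L {H} {s} wf leaves =
    node wf (cut (lhs s) (rhs s) x) (≋-refl , ≋-refl) (branch true ∷ branch false ∷ [])
    where
      branch : ∀ b → Proof ((s , false) ∷ H) (insert b x s)
      branch b = cutOnAll xs (xs⊆L ∘ there) (wf-insert b (xs⊆L (here refl)) wf) λ bs ext foc →
        subst (λ H′ → Proof H′ _) (List.++-assoc ext [ s , false ] H)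
          (leaves (b Vec.∷ bs) (ext ++ [ s , false ]) λ focus → Allₚ.++⁺ (foc (HasFocus-insert b focus)) (focus ∷ []))

  N : ℕ
  N = length L

  World : Set
  World = Vec Bool N

  infix 4 _∈[_]_ _∈ˡ_ _∈ʳ_

  data _∈[_]_ (φ : Fm m) (b : Bool) (ω : World) : Set where
    at : ∀ i → lookup L i ≡ φ → Vec.lookup ω i ≡ b → φ ∈[ b ] ω

  _∈ˡ_ _∈ʳ_ : Fm m → World → Set
  φ ∈ˡ ω = φ ∈[ true ] ω
  φ ∈ʳ ω = φ ∈[ false ] ω

  _∈[_]?_ : ∀ φ b ω → Dec (φ ∈[ b ] ω)
  φ ∈[ b ]? ω = map′ (λ (i , p , q) → at i p q) (λ { (at i p q) → i , p , q })
                  (Fin.any? λ i → (lookup L i ≟ᶠ φ) ×-dec (Vec.lookup ω i Bool.≟ b))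

  ∈[]⇒∈L : ∀ {φ b ω} → φ ∈[ b ] ω → φ ∈ L
  ∈[]⇒∈L (at i refl _) = ∈-lookup i

  components : ∀ {φ b ω} → φ ∈[ b ] ω → ComponentsIn L φ
  components = L-saturated ∘ ∈[]⇒∈L

  side : ∀ {φ} → φ ∈ L → ∀ ω → φ ∈ˡ ω ⊎ φ ∈ʳ ω
  side φ∈L ω with Vec.lookup ω (Any.index φ∈L) in eq
  ... | true = inj₁ (at (Any.index φ∈L) (sym (Anyₚ.lookup-index φ∈L)) eq)
  ... | false = inj₂ (at (Any.index φ∈L) (sym (Anyₚ.lookup-index φ∈L)) eq)

  ⌜_⌝ : World → Seq m
  ⌜ ω ⌝ = cutLeaf L ω ([] ⟹ [])

  ∈-⌜⌝⁺ : ∀ b {φ ω} → φ ∈[ b ] ω → (φ , 𝕦) ∈ part b ⌜ ω ⌝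
  ∈-⌜⌝⁺ b {ω = ω} (at i refl refl) = ∈-cutLeaf⁺ʳ L ω _ i

  ∈-⌜⌝⁻ : ∀ b {ω y} → y ∈ part b ⌜ ω ⌝ → ∃ λ φ → y ≡ (φ , 𝕦) × φ ∈[ b ] ω
  ∈-⌜⌝⁻ b {ω} p with ∈-cutLeaf⁻ L ω b _ p
  ∈-⌜⌝⁻ true p | inj₁ ()
  ∈-⌜⌝⁻ false p | inj₁ ()
  ... | inj₂ (i , ωᵢ≡b , refl) = lookup L i , refl , at i refl ωᵢ≡b

  wf-⌜⌝ : ∀ ω → WellFormed ⌜ ω ⌝
  wf-⌜⌝ ω = wf-cutLeaf L ω (λ p → p) wf-empty

  record Represents (s : Seq m) (ω : World) : Set where
    field
      sound : ∀ b {φ x} → (φ , x) ∈ part b s → φ ∈[ b ] ω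
      complete : ∀ b {φ} → φ ∈[ b ] ω → (φ , 𝕦) ∈ part b s
  open Represents

  ⌜⌝-represents : ∀ {ω} → Represents ⌜ ω ⌝ ω
  ⌜⌝-represents {ω} = record { sound = sound′ ; complete = λ b → ∈-⌜⌝⁺ b }
    where
      sound′ : ∀ b {φ x} → (φ , x) ∈ part b ⌜ ω ⌝ → φ ∈[ b ] ω
      sound′ b p with ∈-⌜⌝⁻ b p
      ... | _ , refl , φ∈ = φ∈

  ⌜⌝-unfocused : ∀ b {ω} → Unfocused (part b ⌜ ω ⌝)
  ⌜⌝-unfocused b p with ∈-⌜⌝⁻ b p
  ... | _ , refl , _ = refl

  represents-addʳ : ∀ {s ω ψ x} → Represents s ω → ψ ∈ʳ ω → Represents (lhs s ⟹ (ψ , x) ∷ rhs s) ω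
  represents-addʳ rep ψ∈ʳ = record
    { sound = λ { true p → sound rep true p ; false (here refl) → ψ∈ʳ ; false (there p) → sound rep false p }
    ; complete = λ { true φ∈ → complete rep true φ∈ ; false φ∈ → there (complete rep false φ∈) } }

  ⌜_⌝[_] : World → Fm m → Seq m
  ⌜ ω ⌝[ ψ ] = lhs ⌜ ω ⌝ ⟹ (ψ , 𝕗) ∷ rhs ⌜ ω ⌝

  represents⇒≈⌜⌝ : ∀ {s ω ψ} → Represents s ω → IsSequent s → (ψ , 𝕗) ∈ rhs s → s ≈ₛ ⌜ ω ⌝[ ψ ]
  represents⇒≈⌜⌝ {s} {ω} {ψ} rep seq ψ∈ = (λ _ → to-lhs , from true) , (λ _ → to-rhs , from-rhs)
    where
      from : ∀ b {y} → y ∈ part b ⌜ ω ⌝ → y ∈ part b s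
      from b p with ∈-⌜⌝⁻ b p
      ... | _ , refl , φ∈ = complete rep b φ∈
      to-lhs : ∀ {y} → y ∈ lhs s → y ∈ lhs ⌜ ω ⌝
      to-lhs {φ , x} p with IsSequent.lhs-unfocused seq φ x p
      ... | refl = ∈-⌜⌝⁺ true (sound rep true p)
      to-rhs : ∀ {y} → y ∈ rhs s → y ∈ (ψ , 𝕗) ∷ rhs ⌜ ω ⌝
      to-rhs {φ , 𝕦} p = there (∈-⌜⌝⁺ false (sound rep false p))
      to-rhs {φ , 𝕗} p with IsSequent.rhs-atMostOne seq φ ψ p ψ∈
      ... | refl = here refl
      from-rhs : ∀ {y} → y ∈ (ψ , 𝕗) ∷ rhs ⌜ ω ⌝ → y ∈ rhs s
      from-rhs (here refl) = ψ∈
      from-rhs (there p) = from false p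

  Clash : Seq m → Set
  Clash s = Any (λ y → Any (λ z → proj₁ y ≡ proj₁ z) (rhs s)) (lhs s)

  clash? : Decidable Clash
  clash? s = Any.any? (λ y → Any.any? (λ z → proj₁ y ≟ᶠ proj₁ z) (rhs s)) (lhs s)

  clash : ∀ {s φ x y} → (φ , x) ∈ lhs s → (φ , y) ∈ rhs s → Clash s
  clash l r = lose l (lose r refl)

  clash⇒proof : ∀ {H s} → WellFormed s → Clash s → Proof H s
  clash⇒proof wf c with find c
  ... | (φ , x) , l , c′ with find c′
  ...   | (_ , y) , r , refl with IsSequent.lhs-unfocused (isSeq wf) φ x l
  ...     | refl = axiom wf l r

  module Leaf {s₀ : Seq m} (wf₀ : WellFormed s₀) (ω : World) (no-clash : ¬ Clash (cutLeaf L ω s₀)) where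

    root-side : ∀ b {φ x} → (φ , x) ∈ part b s₀ → ∀ {i} → lookup L i ≡ φ → Vec.lookup ω i ≡ b
    root-side b p {i} refl = same-side b (Vec.lookup ω i) (∈-cutLeaf⁺ˡ L ω b s₀ p) (∈-cutLeaf⁺ʳ L ω s₀ i)
      where
        same-side : ∀ b c {φ x y} → (φ , x) ∈ part b (cutLeaf L ω s₀) → (φ , y) ∈ part c (cutLeaf L ω s₀) → c ≡ b
        same-side true true _ _ = refl
        same-side true false l r = ⊥-elim (no-clash (clash l r))
        same-side false true r l = ⊥-elim (no-clash (clash l r))
        same-side false false _ _ = refl

    root-∈ : ∀ b {φ x} → (φ , x) ∈ part b s₀ → φ ∈[ b ] ω
    root-∈ b p = at (Any.index φ∈L) (sym (Anyₚ.lookup-index φ∈L)) (root-side b p (sym (Anyₚ.lookup-index φ∈L)))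
      where
        φ∈L = ⊆L wf₀ b p

    wellFormed : WellFormed (cutLeaf L ω s₀)
    wellFormed = wf-cutLeaf L ω (λ p → p) wf₀

    represents : Represents (cutLeaf L ω s₀) ω
    represents = record { sound = sound′ ; complete = complete′ }
      where
        sound′ : ∀ b {φ x} → (φ , x) ∈ part b (cutLeaf L ω s₀) → φ ∈[ b ] ω
        sound′ b p with ∈-cutLeaf⁻ L ω b s₀ p
        ... | inj₁ q = root-∈ b q
        ... | inj₂ (i , ωᵢ≡b , refl) = at i refl ωᵢ≡b
        complete′ : ∀ b {φ} → φ ∈[ b ] ω → (φ , 𝕦) ∈ part b (cutLeaf L ω s₀)
        complete′ b (at i refl refl) = ∈-cutLeaf⁺ʳ L ω s₀ i

  unK : Fin m → AF m → List (AF m)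
  unK a (K b χ , x) with a Fin.≟ b
  ... | yes _ = [ χ , x ]
  ... | no _ = []
  unK a _ = []

  ∈-unK⁻ : ∀ a z {y} → y ∈ unK a z → ∃ λ χ → z ≡ (K a χ , proj₂ y) × proj₁ y ≡ χ
  ∈-unK⁻ a (K b χ , x) p with a Fin.≟ b
  ∈-unK⁻ a (K b χ , x) (here refl) | yes refl = χ , refl , refl

  ∈-unK⁺ : ∀ a χ x → (χ , x) ∈ unK a (K a χ , x)
  ∈-unK⁺ a χ x with a Fin.≟ a
  ... | yes refl = here refl
  ... | no a≢a = ⊥-elim (a≢a refl)

  known : Fin m → Bool → World → List (AF m)
  known a b ω = concatMap (unK a) (part b ⌜ ω ⌝)

  boxed : Fin m → Bool → World → List (AF m)
  boxed a b ω = Kl a (known a b ω)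

  ∈-boxed⁺ : ∀ a b {χ ω} → K a χ ∈[ b ] ω → (K a χ , 𝕦) ∈ boxed a b ω
  ∈-boxed⁺ a b {χ} K∈ = ∈-map⁺ _ (∈-concatMap⁺ (unK a) (Any.map (λ { refl → ∈-unK⁺ a χ 𝕦 }) (∈-⌜⌝⁺ b K∈)))

  ∈-boxed⁻ : ∀ a b {ω y} → y ∈ boxed a b ω → ∃ λ χ → y ≡ (K a χ , 𝕦) × K a χ ∈[ b ] ω
  ∈-boxed⁻ a b {ω} p with ∈-map⁻ _ p
  ... | (χ , x) , q , refl with find (∈-concatMap⁻ (unK a) {xs = part b ⌜ ω ⌝} q)
  ...   | z , z∈ , r with ∈-unK⁻ a z r
  ...     | _ , refl , refl with ∈-⌜⌝⁻ b z∈
  ...       | _ , refl , K∈ = χ , refl , K∈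

  infix 4 _⊑_ _~[_]_ _∋_

  _⊑_ : World → World → Set
  _⊑_ = Pointwise Bool._≤_

  ⊑-intro : ∀ {ω v} → (∀ i → Vec.lookup ω i ≡ true → Vec.lookup v i ≡ true) → ω ⊑ v
  ⊑-intro {ω} {v} true⇒true = Pointwise.ext λ i → ≤-at i (Vec.lookup ω i) refl
    where
      ≤-at : ∀ i b → Vec.lookup ω i ≡ b → b Bool.≤ Vec.lookup v i
      ≤-at i false _ = Bool.≤-minimum _
      ≤-at i true ωᵢ with Vec.lookup v i | true⇒true i ωᵢ
      ... | _ | refl = Bool.b≤b

  ⊑-∈ˡ : ∀ {ω v φ} → ω ⊑ v → φ ∈ˡ ω → φ ∈ˡ v
  ⊑-∈ˡ ω⊑v (at i Lᵢ ωᵢ) = at i Lᵢ (true≤ (subst (Bool._≤ _) ωᵢ (Pointwise.app ω⊑v i)))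
    where
      true≤ : ∀ {b} → true Bool.≤ b → b ≡ true
      true≤ Bool.b≤b = refl

  data IsK (a : Fin m) : Fm m → Set where
    K-form : ∀ {φ} → IsK a (K a φ)

  IsK⁻ : ∀ {a φ} → IsK a φ → ∃ λ χ → φ ≡ K a χ
  IsK⁻ K-form = _ , refl

  IsK? : ∀ a φ → Dec (IsK a φ)
  IsK? a (K b φ) = map′ (λ { refl → K-form }) (λ { K-form → refl }) (a Fin.≟ b)
  IsK? a ⊥' = no λ ()
  IsK? a (atom _) = no λ ()
  IsK? a (_ ∧' _) = no λ ()
  IsK? a (_ ∨' _) = no λ ()
  IsK? a (_ ⇒' _) = no λ ()
  IsK? a (C _) = no λ ()

  record _~[_]_ (ω : World) (a : Fin m) (v : World) : Set where
    constructor agree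
    field
      agree-on : ∀ i → IsK a (lookup L i) → Vec.lookup ω i ≡ Vec.lookup v i
  open _~[_]_

  _⊑?_ : ∀ ω v → Dec (ω ⊑ v)
  _⊑?_ = Pointwise.decidable Bool._≤?_

  _~[_]?_ : ∀ ω a v → Dec (ω ~[ a ] v)
  ω ~[ a ]? v = map′ agree agree-on (Fin.all? λ i → IsK? a (lookup L i) →-dec (Vec.lookup ω i Bool.≟ Vec.lookup v i))

  ⊑-antisym : ∀ {ω v} → ω ⊑ v → v ⊑ ω → ω ≡ v
  ⊑-antisym ω⊑v v⊑ω = Pointwise-≡⇒≡ (Pointwise.ext λ i → Bool.≤-antisym (Pointwise.app ω⊑v i) (Pointwise.app v⊑ω i))

  ~-trans : ∀ {a x y z} → x ~[ a ] y → y ~[ a ] z → x ~[ a ] z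
  ~-trans x~y y~z = agree λ i isK → trans (agree-on x~y i isK) (agree-on y~z i isK)

  -- The rule decomposing φ on side b of ⌜ ω ⌝ has only axioms as premises (on the right, among
  -- implications only ¬ K_a χ is decomposed locally, by K⇒).
  Refutes : World → Bool → Fm m → Set
  Refutes ω true ⊥' = ⊤
  Refutes ω true (φ ∧' ψ) = φ ∈ʳ ω ⊎ ψ ∈ʳ ω
  Refutes ω false (φ ∧' ψ) = φ ∈ˡ ω × ψ ∈ˡ ω
  Refutes ω true (φ ∨' ψ) = φ ∈ʳ ω × ψ ∈ʳ ω
  Refutes ω false (φ ∨' ψ) = φ ∈ˡ ω ⊎ ψ ∈ˡ ω
  Refutes ω true (φ ⇒' ψ) = φ ∈ˡ ω × ψ ∈ʳ ω
  Refutes ω false (φ ⇒' ψ) = ψ ≡ ⊥' × (∃ λ a → IsK a φ) × φ ∈ʳ ω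
  Refutes ω true (K a φ) = φ ∈ʳ ω
  Refutes ω true (C φ) = φ ∈ʳ ω ⊎ ∃ λ a → K a (C φ) ∈ʳ ω
  Refutes ω _ _ = ⊥

  Refutes? : ∀ ω b φ → Dec (Refutes ω b φ)
  Refutes? ω true ⊥' = yes tt
  Refutes? ω true (φ ∧' ψ) = φ ∈[ false ]? ω ⊎-dec ψ ∈[ false ]? ω
  Refutes? ω false (φ ∧' ψ) = φ ∈[ true ]? ω ×-dec ψ ∈[ true ]? ω
  Refutes? ω true (φ ∨' ψ) = φ ∈[ false ]? ω ×-dec ψ ∈[ false ]? ω
  Refutes? ω false (φ ∨' ψ) = φ ∈[ true ]? ω ⊎-dec ψ ∈[ true ]? ω
  Refutes? ω true (φ ⇒' ψ) = φ ∈[ true ]? ω ×-dec ψ ∈[ false ]? ω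
  Refutes? ω false (φ ⇒' ψ) = (ψ ≟ᶠ ⊥') ×-dec Fin.any? (λ a → IsK? a φ) ×-dec φ ∈[ false ]? ω
  Refutes? ω true (K a φ) = φ ∈[ false ]? ω
  Refutes? ω true (C φ) = φ ∈[ false ]? ω ⊎-dec Fin.any? (λ a → K a (C φ) ∈[ false ]? ω)
  Refutes? ω true (atom _) = no λ ()
  Refutes? ω false ⊥' = no λ ()
  Refutes? ω false (atom _) = no λ ()
  Refutes? ω false (K _ _) = no λ ()
  Refutes? ω false (C _) = no λ ()

  LocallyBad : World → Set
  LocallyBad ω = ∃ λ i → lookup L i ∈[ not (Vec.lookup ω i) ] ω ⊎ Refutes ω (Vec.lookup ω i) (lookup L i)

  LocallyBad? : ∀ ω → Dec (LocallyBad ω)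
  LocallyBad? ω = Fin.any? λ i →
    lookup L i ∈[ not (Vec.lookup ω i) ]? ω ⊎-dec Refutes? ω (Vec.lookup ω i) (lookup L i)

  _∋_ : Trie N → World → Set
  S ∋ v = Bool.T (S ! v)

  CInvariant : (World → Set) → Fm m → Trie N → Set
  CInvariant P φ S = ∀ v → S ∋ v → φ ∈ˡ v × (∀ a v′ → v ~[ a ] v′ → ¬ P v′ → S ∋ v′)

  NoWitness : (World → Set) → World → Bool → Fm m → Set
  NoWitness P ω true _ = ⊥
  NoWitness P ω false (φ ⇒' ψ) = ∀ v → ω ⊑ v → φ ∈ˡ v → ψ ∈ʳ v → P v
  NoWitness P ω false (K a φ) = ∀ v → ω ~[ a ] v → φ ∈ʳ v → P v
  NoWitness P ω false (C φ) = ∃ λ S → S ∋ ω × CInvariant P φ S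
  NoWitness P ω false _ = ⊥

  Bad : ℕ → World → Set
  Bad zero = LocallyBad
  Bad (suc k) ω = Bad k ω ⊎ ∃ λ i → NoWitness (Bad k) ω (Vec.lookup ω i) (lookup L i)

  open Enumeration (allVecs N) ∈-allVecs
  open Enumeration (allTries N) ∈-allTries using () renaming (∃? to ∃-Trie?)

  module _ {P : World → Set} (P? : ∀ v → Dec (P v)) where

    CInvariant? : ∀ φ S → Dec (CInvariant P φ S)
    CInvariant? φ S = ∀? λ v → Bool.T? (S ! v) →-dec
      (φ ∈[ true ]? v ×-dec Fin.all? λ a → ∀? λ v′ → (v ~[ a ]? v′) →-dec (¬? (P? v′) →-dec Bool.T? (S ! v′)))

    NoWitness? : ∀ ω b φ → Dec (NoWitness P ω b φ)
    NoWitness? ω true _ = no λ ()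
    NoWitness? ω false (φ ⇒' ψ) = ∀? λ v → (ω ⊑? v) →-dec (φ ∈[ true ]? v →-dec (ψ ∈[ false ]? v →-dec P? v))
    NoWitness? ω false (K a φ) = ∀? λ v → (ω ~[ a ]? v) →-dec (φ ∈[ false ]? v →-dec P? v)
    NoWitness? ω false (C φ) = ∃-Trie? λ S → Bool.T? (S ! ω) ×-dec CInvariant? φ S
    NoWitness? ω false ⊥' = no λ ()
    NoWitness? ω false (atom _) = no λ ()
    NoWitness? ω false (_ ∧' _) = no λ ()
    NoWitness? ω false (_ ∨' _) = no λ ()

  Bad? : ∀ k ω → Dec (Bad k ω)
  Bad? zero = LocallyBad?
  Bad? (suc k) ω = Bad? k ω ⊎-dec Fin.any? λ i → NoWitness? (Bad? k) ω (Vec.lookup ω i) (lookup L i)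

  wf-addˡ : ∀ {s φ} → φ ∈ L → WellFormed s → WellFormed ((φ , 𝕦) ∷ lhs s ⟹ rhs s)
  wf-addˡ = wf-insert true

  wf-addʳ : ∀ {s φ} → φ ∈ L → WellFormed s → WellFormed (lhs s ⟹ (φ , 𝕦) ∷ rhs s)
  wf-addʳ = wf-insert false

  wf-CL-premise : ∀ {s φ} → ComponentsIn L (C φ) → WellFormed s →
          WellFormed ((φ , 𝕦) ∷ map (λ a → K a (C φ) , 𝕦) (allFin m) ++ lhs s ⟹ rhs s)
  wf-CL-premise {s} {φ} (φ∈L , K∈L) wf = wf-addˡ φ∈L (wf-extend wf origin)
    where
      origin : ∀ b {ψ x} → (ψ , x) ∈ part b (map (λ a → K a (C φ) , 𝕦) (allFin m) ++ lhs s ⟹ rhs s) →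
            (ψ , x) ∈ part b s ⊎ (x ≡ 𝕦 × ψ ∈ L)
      origin false p = inj₁ p
      origin true p with ∈-++⁻ (map _ (allFin m)) p
      ... | inj₂ q = inj₁ q
      ... | inj₁ q with ∈-map⁻ _ q
      ...   | a , _ , refl = inj₂ (refl , K∈L a)

  module _ {s ω} (rep : Represents s ω) (wf : WellFormed s) where

    private
      Γ = lhs s
      Δ = rhs s
      ˡ : ∀ {ψ} → ψ ∈ˡ ω → (ψ , 𝕦) ∈ Γ
      ˡ = complete rep true
      ʳ : ∀ {ψ} → ψ ∈ʳ ω → (ψ , 𝕦) ∈ Δ
      ʳ = complete rep false

    refutesˡ⇒proof : ∀ {H} φ → φ ∈ˡ ω → Refutes ω true φ → Proof H s
    refutesˡ⇒proof ⊥' φ∈ _ = node wf (bot Γ Δ) (≋-∷ (ˡ φ∈) , ≋-refl) []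
    refutesˡ⇒proof (φ ∧' ψ) ∧∈ r = node wf (∧L Γ Δ φ ψ) (≋-∷ (ˡ ∧∈) , ≋-refl) (premise r ∷ [])
      where
        wf′ = wf-addˡ (proj₁ (components ∧∈)) (wf-addˡ (proj₂ (components ∧∈)) wf)
        premise : ∀ {H} → φ ∈ʳ ω ⊎ ψ ∈ʳ ω → Proof H ((φ , 𝕦) ∷ (ψ , 𝕦) ∷ Γ ⟹ Δ)
        premise (inj₁ φ∈ʳ) = axiom wf′ (here refl) (ʳ φ∈ʳ)
        premise (inj₂ ψ∈ʳ) = axiom wf′ (there (here refl)) (ʳ ψ∈ʳ)
    refutesˡ⇒proof (φ ∨' ψ) ∨∈ (φ∈ʳ , ψ∈ʳ) = node wf (∨L Γ Δ φ ψ) (≋-∷ (ˡ ∨∈) , ≋-refl)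
      (axiom (wf-addˡ (∈[]⇒∈L φ∈ʳ) wf) (here refl) (ʳ φ∈ʳ) ∷ axiom (wf-addˡ (∈[]⇒∈L ψ∈ʳ) wf) (here refl) (ʳ ψ∈ʳ) ∷ [])
    refutesˡ⇒proof (φ ⇒' ψ) ⇒∈ (φ∈ˡ , ψ∈ʳ) = node wf (⇒L Γ Δ φ ψ) (≋-∷ (ˡ ⇒∈) , ≋-refl)
      (axiom (wf-addʳ (∈[]⇒∈L φ∈ˡ) wf) (ˡ φ∈ˡ) (here refl) ∷ axiom (wf-addˡ (∈[]⇒∈L ψ∈ʳ) wf) (here refl) (ʳ ψ∈ʳ) ∷ [])
    refutesˡ⇒proof (K a φ) K∈ φ∈ʳ = node wf (T a Γ Δ φ) (≋-∷ (ˡ K∈) , ≋-refl)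
      (axiom (wf-addˡ (∈[]⇒∈L φ∈ʳ) wf) (here refl) (ʳ φ∈ʳ) ∷ [])
    refutesˡ⇒proof (C φ) C∈ r = node wf (CL Γ Δ φ) (≋-∷ (ˡ C∈) , ≋-refl) (premise r ∷ [])
      where
        wf′ = wf-CL-premise (components C∈) wf
        premise : ∀ {H} → φ ∈ʳ ω ⊎ ∃ (λ a → K a (C φ) ∈ʳ ω) →
                  Proof H ((φ , 𝕦) ∷ map (λ a → K a (C φ) , 𝕦) (allFin m) ++ Γ ⟹ Δ)
        premise (inj₁ φ∈ʳ) = axiom wf′ (here refl) (ʳ φ∈ʳ)
        premise (inj₂ (a , K∈ʳ)) = axiom wf′ (there (∈-++⁺ˡ (∈-map⁺ _ (∈-allFin a)))) (ʳ K∈ʳ)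

    refutesʳ⇒proof : ∀ {H} φ → φ ∈ʳ ω → Refutes ω false φ → Proof H s
    refutesʳ⇒proof (φ ∧' ψ) ∧∈ (φ∈ˡ , ψ∈ˡ) = node wf (∧R Γ Δ φ ψ) (≋-refl , ≋-∷ (ʳ ∧∈))
      (axiom (wf-addʳ (∈[]⇒∈L φ∈ˡ) wf) (ˡ φ∈ˡ) (here refl) ∷ axiom (wf-addʳ (∈[]⇒∈L ψ∈ˡ) wf) (ˡ ψ∈ˡ) (here refl) ∷ [])
    refutesʳ⇒proof (φ ∨' ψ) ∨∈ r = node wf (∨R Γ Δ φ ψ) (≋-refl , ≋-∷ (ʳ ∨∈)) (premise r ∷ [])
      where
        wf′ = wf-addʳ (proj₁ (components ∨∈)) (wf-addʳ (proj₂ (components ∨∈)) wf)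
        premise : ∀ {H} → φ ∈ˡ ω ⊎ ψ ∈ˡ ω → Proof H (Γ ⟹ (φ , 𝕦) ∷ (ψ , 𝕦) ∷ Δ)
        premise (inj₁ φ∈ˡ) = axiom wf′ (ˡ φ∈ˡ) (here refl)
        premise (inj₂ ψ∈ˡ) = axiom wf′ (ˡ ψ∈ˡ) (there (here refl))
    refutesʳ⇒proof (K a χ ⇒' ⊥') ¬K∈ (refl , (_ , K-form) , K∈ʳ) = node wf (K⇒ a Γ Δ χ ⊥') (≋-refl , ≋-∷ (ʳ ¬K∈))
      (axiom (wf-addˡ (∈[]⇒∈L K∈ʳ) (wf-addʳ (proj₂ (components ¬K∈)) wf)) (here refl) (there (ʳ K∈ʳ)) ∷ [])

    refutes⇒proof : ∀ {H b φ} → φ ∈[ b ] ω → Refutes ω b φ → Proof H s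
    refutes⇒proof {b = true} = refutesˡ⇒proof _
    refutes⇒proof {b = false} = refutesʳ⇒proof _

  locallyBad⇒proof : ∀ {H s ω} → Represents s ω → WellFormed s → LocallyBad ω → Proof H s
  locallyBad⇒proof {ω = ω} rep wf (i , inj₁ opposite) = contradiction _ (at i refl refl) opposite
    where
      contradiction : ∀ {H φ} b → φ ∈[ b ] ω → φ ∈[ not b ] ω → Proof H _
      contradiction true φ∈ˡ φ∈ʳ = axiom wf (complete rep true φ∈ˡ) (complete rep false φ∈ʳ)
      contradiction false φ∈ʳ φ∈ˡ = axiom wf (complete rep true φ∈ˡ) (complete rep false φ∈ʳ)
  locallyBad⇒proof rep wf (i , inj₂ r) = refutes⇒proof rep wf (at i refl refl) r

  ClashFreeLeavesProvable : Seq m → History m → Set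
  ClashFreeLeavesProvable s₀ H = ∀ ω ext → (HasFocus s₀ → All (HasFocus ∘ proj₁) ext) →
                                 ¬ Clash (cutLeaf L ω s₀) → Proof (ext ++ H) (cutLeaf L ω s₀)

  analyticCut : ∀ {H s₀} → WellFormed s₀ → ClashFreeLeavesProvable s₀ H → Proof H s₀
  analyticCut {H} {s₀} wf₀ leaf = cutOnAll L (λ p → p) wf₀ λ ω ext foc → case ω ext foc (clash? (cutLeaf L ω s₀))
    where
      case : ∀ ω ext → (HasFocus s₀ → All (HasFocus ∘ proj₁) ext) → Dec (Clash (cutLeaf L ω s₀)) →
             Proof (ext ++ H) (cutLeaf L ω s₀)
      case ω ext foc (yes c) = clash⇒proof (wf-cutLeaf L ω (λ p → p) wf₀) c
      case ω ext foc (no nc) = leaf ω ext foc nc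

  BadProvable : ℕ → Set
  BadProvable k = ∀ {H s ω} → Bad k ω → Represents s ω → WellFormed s → Proof H s

  boxed⊆ : ∀ {s ω} → Represents s ω → ∀ a b {y} → y ∈ boxed a b ω → y ∈ part b s
  boxed⊆ rep a b p with ∈-boxed⁻ a b p
  ... | _ , refl , K∈ = complete rep b K∈

  boxed-unfocused : ∀ a b {ω} → Unfocused (boxed a b ω)
  boxed-unfocused a b p with ∈-boxed⁻ a b p
  ... | _ , refl , _ = refl

  boxed⊆L : ∀ a b {ω φ x} → (φ , x) ∈ boxed a b ω → φ ∈ L
  boxed⊆L a b p with ∈-boxed⁻ a b p
  ... | _ , refl , K∈ = ∈[]⇒∈L K∈

  wf-boxed : ∀ a ω → WellFormed (boxed a true ω ⟹ boxed a false ω)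
  wf-boxed a ω = wf-extend wf-empty λ
    { true p → inj₂ (boxed-unfocused a true p , boxed⊆L a true p)
    ; false p → inj₂ (boxed-unfocused a false p , boxed⊆L a false p) }

  boxed-root⇒~ : ∀ {s₀ ω} (wf₀ : WellFormed s₀) a → (∀ b {y} → y ∈ boxed a b ω → y ∈ part b s₀) →
           ∀ v → ¬ Clash (cutLeaf L v s₀) → ω ~[ a ] v
  boxed-root⇒~ {ω = ω} wf₀ a boxed⊆s₀ v nc = agree agree-at
    where
      agree-at : ∀ i → IsK a (lookup L i) → Vec.lookup ω i ≡ Vec.lookup v i
      agree-at i isK with IsK⁻ isK
      ... | _ , Lᵢ≡K = sym (Leaf.root-side wf₀ v nc ωᵢ (boxed⊆s₀ ωᵢ (∈-boxed⁺ a ωᵢ (at i Lᵢ≡K refl))) Lᵢ≡K)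
        where
          ωᵢ = Vec.lookup ω i

  module _ {k : ℕ} (ih : BadProvable k) where

    ⇒-noWitness⇒proof : ∀ {H s ω φ ψ} → Represents s ω → WellFormed s → φ ⇒' ψ ∈ʳ ω →
                         NoWitness (Bad k) ω false (φ ⇒' ψ) → Proof H s
    ⇒-noWitness⇒proof {s = s} {ω} {φ} {ψ} rep wf ⇒∈ʳ noWitness =
      node wf (⇒R (lhs s) (rhs s) φ ψ) (≋-refl , ≋-∷ (complete rep false ⇒∈ʳ)) (analyticCut wf₀ leaf ∷ [])
      where
        wf₀ : WellFormed ((φ , 𝕦) ∷ lhs s ⟹ (ψ , 𝕦) ∷ [])
        wf₀ = wf-addˡ (proj₁ (components ⇒∈ʳ)) (wf-addʳ (proj₂ (components ⇒∈ʳ))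
                (wf-extend wf λ { true p → inj₁ p ; false () }))
        leaf : ∀ {H} → ClashFreeLeavesProvable ((φ , 𝕦) ∷ lhs s ⟹ (ψ , 𝕦) ∷ []) H
        leaf v _ _ nc =
          ih (noWitness v ω⊑v (root-∈ true (here refl)) (root-∈ false (here refl))) represents wellFormed
          where
            open Leaf wf₀ v nc
            ω⊑v : ω ⊑ v
            ω⊑v = ⊑-intro λ i ωᵢ → root-side true (there (complete rep true (at i refl ωᵢ))) refl

    K-noWitness⇒proof : ∀ {H s ω a φ} → Represents s ω → WellFormed s → K a φ ∈ʳ ω →
                       NoWitness (Bad k) ω false (K a φ) → Proof H s
    K-noWitness⇒proof {s = s} {ω} {a} {φ} rep wf K∈ʳ noWitness =
      node wf (S5 a (lhs s) (known a true ω) (known a false ω) (rhs s) φ 𝕦) (eqL , eqR) (analyticCut wf₀ leaf ∷ [])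
      where
        eqL : lhs s ≋ (lhs s ++ boxed a true ω)
        eqL = ≋-absorbʳ (boxed⊆ rep a true)
        eqR : rhs s ≋ ((K a φ , 𝕦) ∷ boxed a false ω ++ rhs s)
        eqR = ≋-absorbˡ λ { (here refl) → complete rep false K∈ʳ ; (there p) → boxed⊆ rep a false p }
        wf₀ : WellFormed (boxed a true ω ⟹ (φ , 𝕦) ∷ boxed a false ω)
        wf₀ = wf-addʳ (proj₁ (components K∈ʳ)) (wf-boxed a ω)
        leaf : ∀ {H} → ClashFreeLeavesProvable (boxed a true ω ⟹ (φ , 𝕦) ∷ boxed a false ω) H
        leaf v _ _ nc = ih (noWitness v ω~v (root-∈ false (here refl))) represents wellFormed
          where
            open Leaf wf₀ v nc
            ω~v : ω ~[ a ] v
            ω~v = boxed-root⇒~ wf₀ a (λ { true p → p ; false p → there p }) v nc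

    module Exploration {φ : Fm m} (C∈L : C φ ∈ L) (S : Trie N) (invariant : CInvariant (Bad k) φ S) where

      -- Each visited world has an ancestor node, the conclusion of a focused CR step, whose sequent
      -- is that world's; every node below it keeps C φ or K_a C φ in focus, so meeting the world
      -- again closes the branch by a successful repetition.
      Visited : List World → History m → Set
      Visited vs H = ∀ {v} → v ∈ vs → ∃ λ pre → ∃ λ t → ∃ λ rest →
                       H ≡ pre ++ (t , true) ∷ rest × t ≈ₛ ⌜ v ⌝[ C φ ] × All (HasFocus ∘ proj₁) pre

      focus∈ : ∀ {t v} → t ≈ₛ ⌜ v ⌝[ C φ ] → (C φ , 𝕗) ∈ rhs t
      focus∈ t≈ = proj₂ (proj₂ t≈ _) (here refl)

      repetition : ∀ {vs H v t} → Visited vs H → v ∈ vs → t ≈ₛ ⌜ v ⌝[ C φ ] → SuccessfulRepetition H t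
      repetition visited v∈ t≈ with visited v∈
      ... | pre , t′ , rest , refl , t′≈ , foc =
        pre , (t′ , true) , rest , refl , ≈ₛ-trans t′≈ (≈ₛ-sym t≈) , (C φ , focus∈ t≈) ,
        Allₚ.++⁺ foc ((C φ , focus∈ t′≈) ∷ []) , Anyₚ.++⁺ʳ pre (here refl)

      visited-∷ : ∀ {vs H v t ext s′} → Visited vs H → t ≈ₛ ⌜ v ⌝[ C φ ] →
                  All (HasFocus ∘ proj₁) ext → HasFocus s′ → Visited (v ∷ vs) (ext ++ (s′ , false) ∷ (t , true) ∷ H)
      visited-∷ {H = H} {t = t} {ext} {s′} _ t≈ foc-ext foc-s′ (here refl) =
        ext ++ [ s′ , false ] , t , H , sym (List.++-assoc ext [ s′ , false ] ((t , true) ∷ H)) , t≈ ,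
        Allₚ.++⁺ foc-ext (foc-s′ ∷ [])
      visited-∷ {t = t} {ext} {s′} visited t≈ foc-ext foc-s′ (there v∈) with visited v∈
      ... | pre , t′ , rest , refl , t′≈ , foc =
        ext ++ (s′ , false) ∷ (t , true) ∷ pre , t′ , rest ,
        sym (List.++-assoc ext ((s′ , false) ∷ (t , true) ∷ pre) _) , t′≈ ,
        Allₚ.++⁺ foc-ext (foc-s′ ∷ (C φ , focus∈ t≈) ∷ foc)

      _∈?_ : ∀ (v : World) vs → Dec (v ∈ vs)
      v ∈? vs = Any.any? (≡-dec Bool._≟_ v) vs

      unvisited : List World → ℕ
      unvisited vs = count (λ v → ¬? (v ∈? vs))

      unvisited-∷ : ∀ {v : World} {vs} → ¬ v ∈ vs → unvisited (v ∷ vs) < unvisited vs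
      unvisited-∷ {v} {vs} v∉ =
        count-strict (λ w → ¬? (w ∈? (v ∷ vs))) (λ w → ¬? (w ∈? vs)) (λ w∉ w∈ → w∉ (there w∈))
          v (λ v∉′ → v∉′ (here refl)) v∉

      Explores : List World → Set
      Explores vs = ∀ {v H t} → S ∋ v → ¬ v ∈ vs → t ≈ₛ ⌜ v ⌝[ C φ ] → WellFormed t → Visited vs H → Proof H t

      module Step {vs v H t} (v∈S : S ∋ v) (t≈ : t ≈ₛ ⌜ v ⌝[ C φ ]) (wf : WellFormed t) (visited : Visited vs H) where

        ⌜⌝⊆lhs : ∀ {y} → y ∈ lhs ⌜ v ⌝ → y ∈ lhs t
        ⌜⌝⊆lhs = proj₂ (proj₁ t≈ _)

        wf-base : WellFormed (lhs t ⟹ rhs ⌜ v ⌝)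
        wf-base = wf-extend wf λ { true p → inj₁ p ; false p → inj₂ (⌜⌝-unfocused false p , ⊆L (wf-⌜⌝ v) false p) }

        φ-premise : ∀ {H′} → Proof H′ (lhs t ⟹ (φ , 𝕦) ∷ rhs ⌜ v ⌝)
        φ-premise = axiom (wf-addʳ (∈[]⇒∈L φ∈ˡ) wf-base) (⌜⌝⊆lhs (∈-⌜⌝⁺ true φ∈ˡ)) (here refl)
          where
            φ∈ˡ = proj₁ (invariant v v∈S)

        agent-premise : Explores (v ∷ vs) → ∀ a → Proof ((t , true) ∷ H) (lhs t ⟹ (K a (C φ) , 𝕗) ∷ rhs ⌜ v ⌝)
        agent-premise explore′ a =
          node wfₐ (S5 a (lhs t) (known a true v) (known a false v) (rhs ⌜ v ⌝) (C φ) 𝕗) (eqL , eqR)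
            (analyticCut wf₀ leaf ∷ [])
          where
            sₐ = lhs t ⟹ (K a (C φ) , 𝕗) ∷ rhs ⌜ v ⌝
            s₀ = boxed a true v ⟹ (C φ , 𝕗) ∷ boxed a false v
            wfₐ : WellFormed sₐ
            wfₐ = wf-focus (proj₂ (L-saturated C∈L) a) isKC (⌜⌝-unfocused false) wf-base
            eqL : lhs t ≋ (lhs t ++ boxed a true v)
            eqL = ≋-absorbʳ (⌜⌝⊆lhs ∘ boxed⊆ ⌜⌝-represents a true)
            eqR : ((K a (C φ) , 𝕗) ∷ rhs ⌜ v ⌝) ≋ ((K a (C φ) , 𝕗) ∷ boxed a false v ++ rhs ⌜ v ⌝)
            eqR = ≋-∷⁺ (≋-absorbˡ (boxed⊆ ⌜⌝-represents a false))
            wf₀ : WellFormed s₀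
            wf₀ = wf-focus C∈L isC (boxed-unfocused a false) (wf-boxed a v)
            leaf : ClashFreeLeavesProvable s₀ ((sₐ , false) ∷ (t , true) ∷ H)
            leaf v′ ext foc nc = continue (Bad? k v′) (v′ ∈? (v ∷ vs))
              where
                open Leaf wf₀ v′ nc
                leaf≈ : cutLeaf L v′ s₀ ≈ₛ ⌜ v′ ⌝[ C φ ]
                leaf≈ = represents⇒≈⌜⌝ represents (isSeq wellFormed) (∈-cutLeaf⁺ˡ L v′ false s₀ (here refl))
                visited′ : Visited (v ∷ vs) (ext ++ (sₐ , false) ∷ (t , true) ∷ H)
                visited′ = visited-∷ visited t≈ (foc (C φ , here refl)) (K a (C φ) , here refl)
                v~v′ : v ~[ a ] v′
                v~v′ = boxed-root⇒~ wf₀ a (λ { true p → p ; false p → there p }) v′ nc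
                continue : Dec (Bad k v′) → Dec (v′ ∈ v ∷ vs) →
                           Proof (ext ++ (sₐ , false) ∷ (t , true) ∷ H) (cutLeaf L v′ s₀)
                continue (yes bad) _ = ih bad represents wellFormed
                continue (no _) (yes seen) =
                  repeat (isSeq wellFormed) (formulasIn wellFormed) (repetition visited′ seen leaf≈)
                continue (no good) (no unseen) =
                  explore′ (proj₂ (invariant v v∈S) a v′ v~v′ good) unseen leaf≈ wellFormed visited′

      explore : ∀ vs → Acc _<_ (unvisited vs) → Explores vs
      explore vs (acc more) {v} {H} {t} v∈S v∉ t≈ wf visited with side C∈L v
      ... | inj₁ C∈ˡ = axiom wf (⌜⌝⊆lhs (∈-⌜⌝⁺ true C∈ˡ)) (focus∈ t≈)
        where
          open Step v∈S t≈ wf visited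
      ... | inj₂ _ = node wf (CR (lhs t) (rhs ⌜ v ⌝) φ 𝕗) (≋-refl , proj₂ t≈)
                       (φ-premise ∷ Allₚ.map⁺ (All.tabulate λ {a} _ → agent-premise explore′ a))
        where
          open Step v∈S t≈ wf visited
          explore′ = explore (v ∷ vs) (more (unvisited-∷ v∉))

    C-noWitness⇒proof : ∀ {H s ω φ} → Represents s ω → WellFormed s → Unfocused (rhs s) → C φ ∈ʳ ω →
                             NoWitness (Bad k) ω false (C φ) → Proof H s
    C-noWitness⇒proof {s = s} {ω} {φ} rep wf unf C∈ʳ (S , ω∈S , invariant) =
      node wf (f (lhs s) (rhs s) (C φ)) (≋-refl , ≋-∷ (complete rep false C∈ʳ))
        (explore [] (<-wellFounded _) ω∈S (λ ()) t≈ wfₜ (λ ()) ∷ [])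
      where
        open Exploration (∈[]⇒∈L C∈ʳ) S invariant
        wfₜ : WellFormed (lhs s ⟹ (C φ , 𝕗) ∷ rhs s)
        wfₜ = wf-focus (∈[]⇒∈L C∈ʳ) isC unf wf
        t≈ : (lhs s ⟹ (C φ , 𝕗) ∷ rhs s) ≈ₛ ⌜ ω ⌝[ C φ ]
        t≈ = represents⇒≈⌜⌝ (represents-addʳ rep C∈ʳ) (isSeq wfₜ) (here refl)

    noWitness⇒proof : ∀ {H s ω b φ} → Represents s ω → WellFormed s → Unfocused (rhs s) → φ ∈[ b ] ω →
                      NoWitness (Bad k) ω b φ → Proof H s
    noWitness⇒proof {b = false} {φ ⇒' ψ} rep wf _ φ∈ = ⇒-noWitness⇒proof rep wf φ∈
    noWitness⇒proof {b = false} {K a φ} rep wf _ φ∈ = K-noWitness⇒proof rep wf φ∈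
    noWitness⇒proof {b = false} {C φ} rep wf unf φ∈ = C-noWitness⇒proof rep wf unf φ∈

  bad⇒proof : ∀ k → BadProvable k
  bad⇒proof-unfocused : ∀ k {H s ω} → Bad k ω → Represents s ω → WellFormed s → Unfocused (rhs s) → Proof H s

  bad⇒proof k {s = s} {ω} bad rep wf with focused? (rhs s)
  ... | inj₂ unf = bad⇒proof-unfocused k bad rep wf unf
  ... | inj₁ (ψ , ψ∈) =
    node wf (u (lhs ⌜ ω ⌝) (rhs ⌜ ω ⌝) ψ) (represents⇒≈⌜⌝ rep (isSeq wf) ψ∈)
      (bad⇒proof-unfocused k bad (represents-addʳ ⌜⌝-represents ψ∈ʳ) (wf-addʳ (∈[]⇒∈L ψ∈ʳ) (wf-⌜⌝ ω))
         (λ { (here refl) → refl ; (there p) → ⌜⌝-unfocused false p }) ∷ [])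
    where
      ψ∈ʳ = sound rep false ψ∈

  bad⇒proof-unfocused zero bad rep wf _ = locallyBad⇒proof rep wf bad
  bad⇒proof-unfocused (suc k) (inj₁ bad) rep wf unf = bad⇒proof-unfocused k bad rep wf unf
  bad⇒proof-unfocused (suc k) (inj₂ (i , noWitness)) rep wf unf =
    noWitness⇒proof {k} (bad⇒proof k) rep wf unf (at i refl refl) noWitness

  locallyBad⇒Bad : ∀ k {ω} → LocallyBad ω → Bad k ω
  locallyBad⇒Bad zero bad = bad
  locallyBad⇒Bad (suc k) bad = inj₁ (locallyBad⇒Bad k bad)

  J : ℕ
  J = proj₁ (stabilises Bad? inj₁)

  Good : World → Set
  Good ω = ¬ Bad J ω

  bad-by-contradiction : ∀ {ω b φ} → φ ∈[ b ] ω → φ ∈[ not b ] ω → Bad J ω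
  bad-by-contradiction (at i refl refl) φ∈ = locallyBad⇒Bad J (i , inj₁ φ∈)

  bad-by-refutation : ∀ {ω b φ} → φ ∈[ b ] ω → Refutes ω b φ → Bad J ω
  bad-by-refutation (at i refl refl) r = locallyBad⇒Bad J (i , inj₂ r)

  bad-by-noWitness : ∀ {ω b φ} → φ ∈[ b ] ω → NoWitness (Bad J) ω b φ → Bad J ω
  bad-by-noWitness (at i refl refl) noWitness = proj₂ (stabilises Bad? inj₁) _ (inj₂ (i , noWitness))

  on-left : ∀ {ω φ} → Good ω → φ ∈ L → (φ ∈ʳ ω → Bad J ω) → φ ∈ˡ ω
  on-left {ω} good φ∈L bad = [ (λ φ∈ˡ → φ∈ˡ) , ⊥-elim ∘ good ∘ bad ]′ (side φ∈L ω)

  on-right : ∀ {ω φ} → Good ω → φ ∈ L → (φ ∈ˡ ω → Bad J ω) → φ ∈ʳ ω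
  on-right {ω} good φ∈L bad = [ ⊥-elim ∘ good ∘ bad , (λ φ∈ʳ → φ∈ʳ) ]′ (side φ∈L ω)

  -- A K_a-formula on the right of ω and the left of v would put ¬ K_a χ on the left of ω (else K⇒
  -- refutes ω), hence of v, which then contains K_a χ and its negation.
  ⊑⇒~ : ∀ {ω v} a → Good ω → Good v → ω ⊑ v → ω ~[ a ] v
  ⊑⇒~ {ω} {v} a good-ω good-v ω⊑v = agree agree-at
    where
      agree-at : ∀ i → IsK a (lookup L i) → Vec.lookup ω i ≡ Vec.lookup v i
      agree-at i isK with IsK⁻ isK | Vec.lookup ω i in ωᵢ | Vec.lookup v i in vᵢ
      ... | _ | true | true = refl
      ... | _ | false | false = refl
      ... | χ , Lᵢ≡K | true | false with ⊑-∈ˡ ω⊑v (at i Lᵢ≡K ωᵢ)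
      ...   | at j Lⱼ≡K vⱼ = ⊥-elim (good-v (bad-by-contradiction (at j Lⱼ≡K vⱼ) (at i Lᵢ≡K vᵢ)))
      agree-at i isK | χ , Lᵢ≡K | false | true = ⊥-elim (good-v (bad-by-refutation ¬K∈ˡv (K∈ˡv , ⊥∈ʳv)))
        where
          K∈ʳω : K a χ ∈ʳ ω
          K∈ʳω = at i Lᵢ≡K ωᵢ
          K∈ˡv : K a χ ∈ˡ v
          K∈ˡv = at i Lᵢ≡K vᵢ
          ¬K∈L = proj₂ (components K∈ʳω)
          ¬K∈ˡv : ¬' (K a χ) ∈ˡ v
          ¬K∈ˡv = ⊑-∈ˡ ω⊑v (on-left good-ω ¬K∈L λ ¬K∈ʳ → bad-by-refutation ¬K∈ʳ (refl , (a , K-form) , K∈ʳω))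
          ⊥∈ʳv : ⊥' ∈ʳ v
          ⊥∈ʳv = on-right good-v (proj₂ (L-saturated ¬K∈L)) (λ ⊥∈ˡ → bad-by-refutation ⊥∈ˡ tt)

  -- Bad worlds are isolated points: the frame conditions then hold everywhere, while the truth
  -- lemma only ever visits good worlds.
  data OnGood (R : World → World → Set) (ω : World) : World → Set where
    reflexive : OnGood R ω ω
    between : ∀ {v} → Good ω → Good v → R ω v → OnGood R ω v

  module _ {R : World → World → Set} where

    onGood-trans : (∀ {x y z} → R x y → R y z → R x z) → ∀ {x y z} → OnGood R x y → OnGood R y z → OnGood R x z
    onGood-trans _ reflexive q = q
    onGood-trans _ p reflexive = p
    onGood-trans trans-R (between gx _ r) (between _ gz r′) = between gx gz (trans-R r r′)

    onGood-sym : (∀ {x y} → R x y → R y x) → ∀ {x y} → OnGood R x y → OnGood R y x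
    onGood-sym _ reflexive = reflexive
    onGood-sym sym-R (between gx gy r) = between gy gx (sym-R r)

    onGood-good : ∀ {x y} → OnGood R x y → Good x → Good y
    onGood-good reflexive gx = gx
    onGood-good (between _ gy _) _ = gy

  canonicalFrame : Frame m
  canonicalFrame = record
    { W = World
    ; inhabited = Vec.replicate N false
    ; _≤_ = OnGood _⊑_
    ; ≤-refl = reflexive
    ; ≤-trans = onGood-trans (Pointwise.trans Bool.≤-trans)
    ; ≤-antisym = antisym
    ; R = λ a → OnGood _~[ a ]_
    ; R-refl = reflexive
    ; R-sym = onGood-sym λ x~y → agree λ i isK → sym (agree-on x~y i isK)
    ; R-trans = onGood-trans ~-trans
    ; confluence = confluence
    }
    where
      antisym : ∀ {x y} → OnGood _⊑_ x y → OnGood _⊑_ y x → x ≡ y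
      antisym reflexive _ = refl
      antisym (between _ _ _) reflexive = refl
      antisym (between _ _ x⊑y) (between _ _ y⊑x) = ⊑-antisym x⊑y y⊑x
      confluence : ∀ {a x y z} → OnGood _⊑_ x y → OnGood _~[ a ]_ y z → OnGood _~[ a ]_ x z
      confluence reflexive y~z = y~z
      confluence {a} (between gx gy x⊑y) reflexive = between gx gy (⊑⇒~ a gx gy x⊑y)
      confluence {a} (between gx gy x⊑y) (between _ gz y~z) = between gx gz (~-trans (⊑⇒~ a gx gy x⊑y) y~z)

  canonicalModel : Model m
  canonicalModel = record { frame = canonicalFrame ; V = λ ω p → atom p ∈ˡ ω ; V-mono = mono }
    where
      mono : ∀ {x y p} → OnGood _⊑_ x y → atom p ∈ˡ x → atom p ∈ˡ y
      mono reflexive p∈ = p∈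
      mono (between _ _ x⊑y) p∈ = ⊑-∈ˡ x⊑y p∈

  infix 4 _⊨_

  _⊨_ : World → Fm m → Set
  ω ⊨ φ = _⊩_ canonicalModel ω φ

  ~-∈ : ∀ {ω v a b φ} → ω ~[ a ] v → K a φ ∈[ b ] ω → K a φ ∈[ b ] v
  ~-∈ ω~v (at i Lᵢ≡K ωᵢ) = at i Lᵢ≡K (trans (sym (agree-on ω~v i (subst (IsK _) (sym Lᵢ≡K) K-form))) ωᵢ)

  onGood-⊑-∈ˡ : ∀ {ω v φ} → OnGood _⊑_ ω v → φ ∈ˡ ω → φ ∈ˡ v
  onGood-⊑-∈ˡ reflexive φ∈ = φ∈
  onGood-⊑-∈ˡ (between _ _ ω⊑v) φ∈ = ⊑-∈ˡ ω⊑v φ∈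

  onGood-~-∈ : ∀ {ω v a b φ} → OnGood _~[ a ]_ ω v → K a φ ∈[ b ] ω → K a φ ∈[ b ] v
  onGood-~-∈ reflexive K∈ = K∈
  onGood-~-∈ (between _ _ ω~v) K∈ = ~-∈ ω~v K∈

  C-propagates : ∀ {ω v φ} → Good ω → C φ ∈ˡ ω → Star (Rany canonicalModel) ω v → Good v × C φ ∈ˡ v
  C-propagates good C∈ ε = good , C∈
  C-propagates {φ = φ} good C∈ ((a , ωRω′) ◅ path) = C-propagates good′ C∈′ path
    where
      good′ = onGood-good ωRω′ good
      K∈ : K a (C φ) ∈ˡ _
      K∈ = on-left good (proj₂ (components C∈) a) λ K∈ʳ → bad-by-refutation C∈ (inj₂ (a , K∈ʳ))
      C∈′ = on-left good′ (∈[]⇒∈L C∈) λ C∈ʳ → bad-by-refutation (onGood-~-∈ ωRω′ K∈) C∈ʳ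

  -- The conclusion is a negation, so Reaches may be assumed decidable.
  ⊨C⇒¬¬noWitness : ∀ {φ ω} → (∀ {v} → Good v → φ ∈ʳ v → ¬ v ⊨ φ) → φ ∈ L →
                    Good ω → ω ⊨ C φ → ¬ ¬ NoWitness (Bad J) ω false (C φ)
  ⊨C⇒¬¬noWitness {φ} falsity-φ φ∈L good ⊨C noWitness = ¬¬-decidable Reaches λ reaches? →
    noWitness (reachable reaches? , ∈-reachable reaches? (good , ⊨C) , invariant reaches?)
    where
      Reaches : World → Set
      Reaches v = Good v × v ⊨ C φ
      module _ (reaches? : ∀ v → Dec (Reaches v)) where
        reachable : Trie N
        reachable = tabulate (isYes ∘ reaches?)
        ∈-reachable : ∀ {v} → Reaches v → reachable ∋ v
        ∈-reachable {v} r = subst Bool.T (sym (tabulate-! (isYes ∘ reaches?) v)) (fromWitness r)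
        reachable⁻ : ∀ {v} → reachable ∋ v → Reaches v
        reachable⁻ {v} r = toWitness (subst Bool.T (tabulate-! (isYes ∘ reaches?) v) r)
        invariant : CInvariant (Bad J) φ reachable
        invariant v v∈ with reachable⁻ v∈
        ... | good-v , ⊨Cv =
          on-left good-v φ∈L (λ φ∈ʳ → ⊥-elim (falsity-φ good-v φ∈ʳ (⊨Cv v ε))) ,
          λ a v′ v~v′ good-v′ → ∈-reachable (good-v′ , λ u path → ⊨Cv u ((a , between good-v good-v′ v~v′) ◅ path))

  truth : ∀ φ {ω} → Good ω → φ ∈ˡ ω → ω ⊨ φ
  falsity : ∀ φ {ω} → Good ω → φ ∈ʳ ω → ¬ ω ⊨ φ

  truth ⊥' good ⊥∈ = good (bad-by-refutation ⊥∈ tt)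
  truth (atom p) _ p∈ = p∈
  truth (φ ∧' ψ) good ∧∈ =
    truth φ good (on-left good (proj₁ (components ∧∈)) (bad-by-refutation ∧∈ ∘ inj₁)) ,
    truth ψ good (on-left good (proj₂ (components ∧∈)) (bad-by-refutation ∧∈ ∘ inj₂))
  truth (φ ∨' ψ) {ω} good ∨∈ with side (proj₁ (components ∨∈)) ω
  ... | inj₁ φ∈ˡ = inj₁ (truth φ good φ∈ˡ)
  ... | inj₂ φ∈ʳ = inj₂ (truth ψ good (on-left good (proj₂ (components ∨∈)) λ ψ∈ʳ → bad-by-refutation ∨∈ (φ∈ʳ , ψ∈ʳ)))
  truth (φ ⇒' ψ) good ⇒∈ v ω≤v ⊨φ =
    truth ψ good-v (on-left good-v ψ∈L λ ψ∈ʳ → bad-by-refutation ⇒∈v (φ∈ˡ , ψ∈ʳ))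
    where
      good-v = onGood-good ω≤v good
      ⇒∈v = onGood-⊑-∈ˡ ω≤v ⇒∈
      ψ∈L = proj₂ (components ⇒∈)
      φ∈ˡ = on-left good-v (proj₁ (components ⇒∈)) λ φ∈ʳ → ⊥-elim (falsity φ good-v φ∈ʳ ⊨φ)
  truth (K a φ) good K∈ v ωRv =
    truth φ good-v (on-left good-v (proj₁ (components K∈)) (bad-by-refutation (onGood-~-∈ ωRv K∈)))
    where
      good-v = onGood-good ωRv good
  truth (C φ) good C∈ v path with C-propagates good C∈ path
  ... | good-v , C∈v = truth φ good-v (on-left good-v (proj₁ (components C∈)) (bad-by-refutation C∈v ∘ inj₁))

  falsity ⊥' _ _ ⊨⊥ = ⊨⊥
  falsity (atom p) good p∈ʳ p∈ˡ = good (bad-by-contradiction p∈ˡ p∈ʳ)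
  falsity (φ ∧' ψ) {ω} good ∧∈ (⊨φ , ⊨ψ) with side (proj₁ (components ∧∈)) ω
  ... | inj₂ φ∈ʳ = falsity φ good φ∈ʳ ⊨φ
  ... | inj₁ φ∈ˡ = falsity ψ good (on-right good (proj₂ (components ∧∈)) λ ψ∈ˡ → bad-by-refutation ∧∈ (φ∈ˡ , ψ∈ˡ)) ⊨ψ
  falsity (φ ∨' ψ) good ∨∈ (inj₁ ⊨φ) =
    falsity φ good (on-right good (proj₁ (components ∨∈)) (bad-by-refutation ∨∈ ∘ inj₁)) ⊨φ
  falsity (φ ∨' ψ) good ∨∈ (inj₂ ⊨ψ) =
    falsity ψ good (on-right good (proj₂ (components ∨∈)) (bad-by-refutation ∨∈ ∘ inj₂)) ⊨ψ
  falsity (φ ⇒' ψ) {ω} good ⇒∈ ⊨⇒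
    with ∃? (λ v → ω ⊑? v ×-dec φ ∈[ true ]? v ×-dec ψ ∈[ false ]? v ×-dec ¬? (Bad? J v))
  ... | yes (v , ω⊑v , φ∈ˡ , ψ∈ʳ , good-v) =
    falsity ψ good-v ψ∈ʳ (⊨⇒ v (between good good-v ω⊑v) (truth φ good-v φ∈ˡ))
  ... | no none = good (bad-by-noWitness ⇒∈ λ v ω⊑v φ∈ˡ ψ∈ʳ →
                    decidable-stable (Bad? J v) λ good-v → none (v , ω⊑v , φ∈ˡ , ψ∈ʳ , good-v))
  falsity (K a φ) {ω} good K∈ ⊨K
    with ∃? (λ v → ω ~[ a ]? v ×-dec φ ∈[ false ]? v ×-dec ¬? (Bad? J v))
  ... | yes (v , ω~v , φ∈ʳ , good-v) = falsity φ good-v φ∈ʳ (⊨K v (between good good-v ω~v))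
  ... | no none = good (bad-by-noWitness K∈ λ v ω~v φ∈ʳ →
                    decidable-stable (Bad? J v) λ good-v → none (v , ω~v , φ∈ʳ , good-v))
  falsity (C φ) good C∈ ⊨C = ⊨C⇒¬¬noWitness (falsity φ) (proj₁ (components C∈)) good ⊨C (good ∘ bad-by-noWitness C∈)

  completeness : ∀ {s} → WellFormed s → ValidS5 s → Proof [] s
  completeness {s} wf valid = analyticCut wf λ ω ext _ nc → leaf ω ext nc (Bad? J ω)
    where
      leaf : ∀ ω ext → ¬ Clash (cutLeaf L ω s) → Dec (Bad J ω) → Proof (ext ++ []) (cutLeaf L ω s)
      leaf ω _ nc (yes bad) = bad⇒proof J bad represents wellFormed
        where
          open Leaf wf ω nc
      leaf ω _ nc (no good) = ⊥-elim (refuted (⊩-⋁ canonicalModel (rhs s) (valid canonicalModel ω ω reflexive ⊨Γ)))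
        where
          open Leaf wf ω nc
          ⊨Γ : ω ⊨ ⋀ (underlying (lhs s))
          ⊨Γ = ⊩-⋀ canonicalModel (lhs s) λ φ∈ → truth _ good (root-∈ true φ∈)
          refuted : (∃ λ y → y ∈ rhs s × ω ⊨ proj₁ y) → ⊥
          refuted ((φ , _) , φ∈ , ⊨φ) = falsity φ good (root-∈ false φ∈) ⊨φ

mainTheorem17 : (n : ℕ) (σ : Seq (suc n)) →
    IsSequent σ → ValidS5 σ → CProof (InClosureOf σ) [] σ
mainTheorem17 n σ isσ valid = CProof-mono (All.map (closureOf⊆Cl base)) (completeness wfσ valid)
  where
    L = closureOf (formulasOf σ)
    open Canonical L (closureOf-saturated (formulasOf σ))
    wfσ : WellFormed σ
    wfσ = record
      { isSeq = isσ
      ; ⊆L = λ { true p → ∈-closureOf (∈-++⁺ˡ (∈-map⁺ proj₁ p))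
               ; false p → ∈-closureOf (∈-++⁺ʳ (underlying (lhs σ)) (∈-map⁺ proj₁ p)) } }
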